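{- Let $\ell\ge2$ and let $S$ be a subgroup of the multiple Riordan group $\mathcal{M}\mathcal{R}$. Then $\{(b|g;f_1,\dots,f_\ell): b\in\mathbb K[[t^\ell]],\ b(0)\ne0,\ (g;f_1,\dots,f_\ell)\in S\}$ is a subgroup of the multiple almost-Riordan group $\mathcal{M}a\mathcal{R}$. Consequently, $\mathcal D=\{(b|h';f_1,\dots,f_\ell)\in\mathcal{M}a\mathcal{R}: h^\ell=f_1f_2\cdots f_\ell\}$ (where $h\in t\mathbb K[[t]]$ and $h'$ is its derivative) is a subgroup of $\mathcal{M}a\mathcal{R}$, and for each $j=1,\dots,\ell$, $\mathcal B_j=\{(b|g;f_1,\dots,f_\ell)\in\mathcal{M}a\mathcal{R}: f_j=tg\}$ is a subgroup of $\mathcal{M}a\mathcal{R}$.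
   Context: Fix an integer $\ell\ge2$ and a field $\mathbb K$ of characteristic $0$ (e.g. $\mathbb C$); $\mathbb K[[t^\ell]]$ denotes the formal power series in $t^\ell$ and $t\mathbb K[[t^\ell]]=\{tw:w\in\mathbb K[[t^\ell]]\}$. For $g\in\mathbb K[[t^\ell]]$ with $g(0)\ne0$ and $f_1,\dots,f_\ell\in t\mathbb K[[t^\ell]]$ with nonzero coefficient of $t$, the multiple Riordan array $(g;f_1,\dots,f_\ell)$ is the infinite lower triangular matrix whose $k$-th column ($k\ge0$) has generating function $g\,f_1^{\lfloor (k+\ell-1)/\ell\rfloor}f_2^{\lfloor (k+\ell-2)/\ell\rfloor}\cdots f_\ell^{\lfloor k/\ell\rfloor}$ (columns $g, gf_1, gf_1f_2,\dots,gf_1\cdots f_\ell, gf_1^2f_2\cdots f_\ell,\dots$); the set $\mathcal{M}\mathcal{R}$ of these is a group under matrix multiplication. For additionally $b\in\mathbb K[[t^\ell]]$ with $b(0)\ne0$, the multiple almost-Riordan array $(b|g;f_1,\dots,f_\ell)$ is the infinite lower triangular matrix whose column $0$ has generating function $b$ and whose column $k\ge1$ has generating function $t\,g\,f_1^{e_1(k)}\cdots f_\ell^{e_\ell(k)}$ with $e_i(k)=\lfloor (k-1+\ell-i)/\ell\rfloor$ (columns $b, tg, tgf_1, tgf_1f_2,\dots$); the set $\mathcal{M}a\mathcal{R}$ of these is a group under matrix multiplication. -}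

module Defs where

open import Level using (Level; _⊔_; suc)
open import Algebra.Bundles using (CommutativeRing)
open import Data.Nat as ℕ using (ℕ; zero; NonZero; _∸_; _≤_)
open import Data.Nat.Divisibility using (_∣_)
open import Data.Fin using (Fin; toℕ)
open import Data.Product using (Σ; _×_; ∃)
open import Relation.Nullary using (¬_)

record Field (c ℓ : Level) : Set (Level.suc (c ⊔ ℓ)) where
  field
    commutativeRing : CommutativeRing c ℓ
  open CommutativeRing commutativeRing public
  field
    1≉0     : ¬ (1# ≈ 0#)
    inverse : ∀ x → ¬ (x ≈ 0#) → ∃ λ y → x * y ≈ 1#

module FieldDefs {c ℓ : Level} (K : Field c ℓ) where
  open Field K

  _·ₙ_ : ℕ → Carrier → Carrier
  zero  ·ₙ x = 0#
  ℕ.suc n ·ₙ x = x + (n ·ₙ x)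

  CharZero : Set ℓ
  CharZero = ∀ n → (ℕ.suc n ·ₙ 1#) ≈ 0# → Data.Empty.⊥
    where import Data.Empty

  Σ< : ℕ → (ℕ → Carrier) → Carrier
  Σ< zero a = 0#
  Σ< (ℕ.suc n) a = Σ< n a + a n

  Series : Set c
  Series = ℕ → Carrier

  _≈ₛ_ : Series → Series → Set ℓ
  a ≈ₛ b = ∀ n → a n ≈ b n

  _⋆_ : Series → Series → Series
  (a ⋆ b) n = Σ< (ℕ.suc n) (λ i → a i * b (n ∸ i))

  oneₛ : Series
  oneₛ zero = 1#
  oneₛ (ℕ.suc n) = 0#

  tₛ : Series
  tₛ zero = 0#
  tₛ (ℕ.suc zero) = 1#
  tₛ (ℕ.suc (ℕ.suc n)) = 0#

  _^ₛ_ : Series → ℕ → Series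
  a ^ₛ zero = oneₛ
  a ^ₛ ℕ.suc n = a ⋆ (a ^ₛ n)

  deriv : Series → Series
  deriv h n = ℕ.suc n ·ₙ h (ℕ.suc n)

  InTK : Series → Set (c ⊔ ℓ)
  InTK h = Σ Series λ w → h ≈ₛ (tₛ ⋆ w)

  -- Everything below depends on ℓ' (the paper's ℓ)

  module WithL (ℓ' : ℕ) .{{_ : NonZero ℓ'}} where

    InKtl : Series → Set ℓ
    InKtl a = ∀ n → ¬ (ℓ' ∣ n) → a n ≈ 0#

    InTKtl : Series → Set (c ⊔ ℓ)
    InTKtl a = Σ Series λ w → InKtl w × (a ≈ₛ (tₛ ⋆ w))

    ValidG : Series → Set ℓ
    ValidG g = InKtl g × ¬ (g 0 ≈ 0#)

    ValidF : Series → Set (c ⊔ ℓ)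
    ValidF f = InTKtl f × ¬ (f 1 ≈ 0#)

    -- f₁,…,f_ℓ indexed by Fin ℓ (index i ↦ f_{i+1})
    ValidFs : (Fin ℓ' → Series) → Set (c ⊔ ℓ)
    ValidFs fs = ∀ i → ValidF (fs i)

    prodFin : ∀ {m} → (Fin m → Series) → Series
    prodFin {zero} s = oneₛ
    prodFin {ℕ.suc m} s = s Fin.zero ⋆ prodFin (λ i → s (Fin.suc i))
      where import Data.Fin as Fin

    prodF : (Fin ℓ' → Series) → Series
    prodF fs = prodFin fs

    -- exponent of f_{i+1} in column k of (g; f₁,…,f_ℓ):
    -- ⌊(k + ℓ - (i+1)) / ℓ⌋
    expo : ℕ → Fin ℓ' → ℕ
    expo k i = (k ℕ.+ ℓ' ∸ ℕ.suc (toℕ i)) ℕ./ ℓ'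

    riordanCol : Series → (Fin ℓ' → Series) → ℕ → Series
    riordanCol g fs k = g ⋆ prodFin (λ i → fs i ^ₛ expo k i)

    Matrix : Set c
    Matrix = ℕ → ℕ → Carrier

    _≈ₘ_ : Matrix → Matrix → Set ℓ
    A ≈ₘ B = ∀ n k → A n k ≈ B n k

    -- product of lower triangular matrices: (AB)_{nj} = Σ_{k ≤ n} A_{nk} B_{kj}
    _·ₘ_ : Matrix → Matrix → Matrix
    (A ·ₘ B) n j = Σ< (ℕ.suc n) (λ k → A n k * B k j)

    Iₘ : Matrix
    Iₘ n k with n ℕ.≟ k
    ... | Relation.Nullary.yes _ = 1#
    ... | Relation.Nullary.no  _ = 0#

    riordan : Series → (Fin ℓ' → Series) → Matrix
    riordan g fs n k = riordanCol g fs k n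

    -- the multiple almost-Riordan array (b | g; f₁,…,f_ℓ):
    -- column 0 is b, column k ≥ 1 is t g f₁^{e₁(k)}⋯f_ℓ^{e_ℓ(k)},
    -- where e_i(k) = ⌊(k-1+ℓ-i)/ℓ⌋ = expo (k-1) i
    almostRiordan : Series → Series → (Fin ℓ' → Series) → Matrix
    almostRiordan b g fs n zero = b n
    almostRiordan b g fs n (ℕ.suc k) = (tₛ ⋆ riordanCol g fs k) n

    InMR : Matrix → Set (c ⊔ ℓ)
    InMR M = Σ Series λ g → Σ (Fin ℓ' → Series) λ fs →
               ValidG g × ValidFs fs × (M ≈ₘ riordan g fs)

    InMaR : Matrix → Set (c ⊔ ℓ)
    InMaR M = Σ Series λ b → Σ Series λ g → Σ (Fin ℓ' → Series) λ fs →
               ValidG b × ValidG g × ValidFs fs × (M ≈ₘ almostRiordan b g fs)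

    -- S is a subgroup of the group G (of matrices under multiplication);
    -- subsets of the setoid of matrices are required to respect ≈ₘ
    record IsSubgroupOf {p q : Level} (G : Matrix → Set p) (S : Matrix → Set q)
           : Set (c ⊔ ℓ ⊔ p ⊔ q) where
      field
        respects : ∀ A B → A ≈ₘ B → S A → S B
        subset   : ∀ A → S A → G A
        hasId    : S Iₘ
        closedMul : ∀ A B → S A → S B → S (A ·ₘ B)
        closedInv : ∀ A → S A →
                    Σ Matrix λ B → S B × ((A ·ₘ B) ≈ₘ Iₘ) × ((B ·ₘ A) ≈ₘ Iₘ)

    LiftSet : {q : Level} → (Matrix → Set q) → Matrix → Set (c ⊔ ℓ ⊔ q)
    LiftSet S M = Σ Series λ b → Σ Series λ g → Σ (Fin ℓ' → Series) λ fs →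
                    ValidG b × ValidG g × ValidFs fs × S (riordan g fs) ×
                    (M ≈ₘ almostRiordan b g fs)

    DSet : Matrix → Set (c ⊔ ℓ)
    DSet M = Σ Series λ b → Σ Series λ h → Σ (Fin ℓ' → Series) λ fs →
               InTK h × ValidG b × ValidG (deriv h) × ValidFs fs ×
               ((h ^ₛ ℓ') ≈ₛ prodF fs) × (M ≈ₘ almostRiordan b (deriv h) fs)

    -- 𝓑_j = { (b|g;f₁,…,f_ℓ) ∈ 𝓜a𝓡 : f_j = t g }  (j ∈ Fin ℓ, 0-based)
    BSet : Fin ℓ' → Matrix → Set (c ⊔ ℓ)
    BSet j M = Σ Series λ b → Σ Series λ g → Σ (Fin ℓ' → Series) λ fs →
                 ValidG b × ValidG g × ValidFs fs × (fs j ≈ₛ (tₛ ⋆ g)) ×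
                 (M ≈ₘ almostRiordan b g fs)

{-# OPTIONS --safe #-}
module Submission where

-- An almost-Riordan array (b | g; F) is lower triangular with first column b and, below it, the
-- Riordan array (g; F) shifted down by t.  Multiplying two of them therefore multiplies the Riordan
-- parts and only changes the first column, and an inverse is obtained from the Riordan inverse by
-- solving one more triangular system for the first column.  So every family of pairs (g; F) that is
-- closed under the products and inverses of 𝓜𝓡 lifts to a subgroup of 𝓜a𝓡, and the three claims
-- are instances: a subgroup S, the pairs with f_j = t g, and the pairs with g = h′, h^ℓ = f₁⋯f_ℓ.
--
-- The engine is the multiplicativity g · R(a c) = R(a) · R(c) of R = (g; F) for c ∈ K[[t^ℓ]], which
-- holds because column qℓ + j of R is column j times (f₁⋯f_ℓ)^q.  It gives the product formula
-- (g; F)(d; H) = (R d; fᵢ · R(hᵢ / t) / g), which visibly preserves f_j = t g.  For 𝓓 one needs in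
-- addition a chain rule: when g = h′ and h^ℓ = f₁⋯f_ℓ, column qℓ of R is (h^(qℓ+1))′ / (qℓ + 1), so
-- ((R κ) · h / g)′ = R ((t κ)′) for κ ∈ K[[t^ℓ]]; this produces the series h for products and inverses.

open import Defs
open import Level using (Level; _⊔_)
open import Data.Empty using (⊥-elim)
open import Data.Product using (_×_; Σ; _,_; proj₁; proj₂)
open import Data.Nat using (ℕ; NonZero; _≤_; zero; suc)
import Data.Nat as ℕ
import Data.Nat.Properties as ℕₚ
open import Data.Nat.DivMod
  using (_%_; _/_; %-distribˡ-+; m*n%n≡0; m≡m%n+[m/n]*n; m%n<n; +-distrib-/-∣ʳ; m*n/n≡m; m<n⇒m/n≡0; m/n≡1+[m∸n]/n)
open import Data.Nat.Divisibility using (_∣_; _∣?_; _∣0; divides; ∣m∣n⇒∣m+n; n∣m⇒m%n≡0; m%n≡0⇒n∣m)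
open import Data.Nat.Induction using (<-rec)
open import Data.Fin as Fin using (Fin; toℕ)
import Data.Fin.Properties as Finₚ
open import Relation.Nullary using (¬_; yes; no)
open import Relation.Binary.Bundles using (Setoid)
open import Relation.Binary.Definitions using (tri<; tri≈; tri>)
open import Relation.Binary.PropositionalEquality as ≡ using (_≡_; _≢_)
import Relation.Binary.Reasoning.Setoid as SetoidReasoning
open import Algebra.Bundles using (CommutativeRing)
import Algebra.Properties.Ring as RingProperties
import Algebra.Properties.CommutativeSemigroup as CommutativeSemigroupProperties

module FieldProperties {c ℓ} (K : Field c ℓ) where
  open Field K hiding (zero)
  open SetoidReasoning setoid

  _⁻¹[_] : ∀ x → x ≉ 0# → Carrier
  x ⁻¹[ x≉0 ] = proj₁ (inverse x x≉0)

  ⁻¹-inverseʳ : ∀ x (x≉0 : x ≉ 0#) → x * x ⁻¹[ x≉0 ] ≈ 1#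
  ⁻¹-inverseʳ x x≉0 = proj₂ (inverse x x≉0)

  ⁻¹-inverseˡ : ∀ x (x≉0 : x ≉ 0#) → x ⁻¹[ x≉0 ] * x ≈ 1#
  ⁻¹-inverseˡ x x≉0 = trans (*-comm _ _) (⁻¹-inverseʳ x x≉0)

  *-cancelˡ-≉0 : ∀ x {y z} → x ≉ 0# → x * y ≈ x * z → y ≈ z
  *-cancelˡ-≉0 x {y} {z} x≉0 xy≈xz = begin
    y                          ≈⟨ *-identityˡ y ⟨
    1# * y                     ≈⟨ *-congʳ (⁻¹-inverseˡ x x≉0) ⟨
    x ⁻¹[ x≉0 ] * x * y        ≈⟨ *-assoc _ _ _ ⟩
    x ⁻¹[ x≉0 ] * (x * y)      ≈⟨ *-congˡ xy≈xz ⟩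
    x ⁻¹[ x≉0 ] * (x * z)      ≈⟨ *-assoc _ _ _ ⟨
    x ⁻¹[ x≉0 ] * x * z        ≈⟨ *-congʳ (⁻¹-inverseˡ x x≉0) ⟩
    1# * z                     ≈⟨ *-identityˡ z ⟩
    z                          ∎

  x*y≈0⇒y≈0 : ∀ x {y} → x ≉ 0# → x * y ≈ 0# → y ≈ 0#
  x*y≈0⇒y≈0 x x≉0 xy≈0 = *-cancelˡ-≉0 x x≉0 (trans xy≈0 (sym (zeroʳ x)))

  *-≉0 : ∀ {x y} → x ≉ 0# → y ≉ 0# → x * y ≉ 0#
  *-≉0 {x} x≉0 y≉0 xy≈0 = y≉0 (x*y≈0⇒y≈0 x x≉0 xy≈0)

  ≉0-resp-≈ : ∀ {x y} → x ≈ y → x ≉ 0# → y ≉ 0#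
  ≉0-resp-≈ x≈y x≉0 y≈0 = x≉0 (trans x≈y y≈0)

module FiniteSums {c ℓ} (K : Field c ℓ) where
  open Field K hiding (zero)
  open FieldDefs K using (Σ<)
  open SetoidReasoning setoid
  open CommutativeSemigroupProperties +-commutativeSemigroup using () renaming (interchange to +-interchange)

  Σ-cong< : ∀ n {a b : ℕ → Carrier} → (∀ i → i ℕ.< n → a i ≈ b i) → Σ< n a ≈ Σ< n b
  Σ-cong< zero a≈b = refl
  Σ-cong< (suc n) a≈b = +-cong (Σ-cong< n (λ i i<n → a≈b i (ℕₚ.m<n⇒m<1+n i<n))) (a≈b n ℕₚ.≤-refl)

  Σ-cong : ∀ n {a b : ℕ → Carrier} → (∀ i → a i ≈ b i) → Σ< n a ≈ Σ< n b
  Σ-cong n a≈b = Σ-cong< n (λ i _ → a≈b i)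

  Σ-≈0 : ∀ n {a : ℕ → Carrier} → (∀ i → i ℕ.< n → a i ≈ 0#) → Σ< n a ≈ 0#
  Σ-≈0 zero a≈0 = refl
  Σ-≈0 (suc n) a≈0 = trans (+-cong (Σ-≈0 n (λ i i<n → a≈0 i (ℕₚ.m<n⇒m<1+n i<n))) (a≈0 n ℕₚ.≤-refl)) (+-identityʳ 0#)

  Σ-+ : ∀ n (a b : ℕ → Carrier) → Σ< n (λ i → a i + b i) ≈ Σ< n a + Σ< n b
  Σ-+ zero a b = sym (+-identityʳ 0#)
  Σ-+ (suc n) a b = trans (+-congʳ (Σ-+ n a b)) (+-interchange _ _ _ _)

  *-distribˡ-Σ : ∀ n x (a : ℕ → Carrier) → x * Σ< n a ≈ Σ< n (λ i → x * a i)
  *-distribˡ-Σ zero x a = zeroʳ x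
  *-distribˡ-Σ (suc n) x a = trans (distribˡ x _ _) (+-congʳ (*-distribˡ-Σ n x a))

  *-distribʳ-Σ : ∀ n x (a : ℕ → Carrier) → Σ< n a * x ≈ Σ< n (λ i → a i * x)
  *-distribʳ-Σ n x a = trans (*-comm _ _) (trans (*-distribˡ-Σ n x a) (Σ-cong n (λ i → *-comm x (a i))))

  Σ-uncons : ∀ n (a : ℕ → Carrier) → Σ< (suc n) a ≈ a 0 + Σ< n (λ i → a (suc i))
  Σ-uncons zero a = trans (+-identityˡ _) (sym (+-identityʳ _))
  Σ-uncons (suc n) a = trans (+-congʳ (Σ-uncons n a)) (+-assoc _ _ _)

  Σ-split : ∀ m n (a : ℕ → Carrier) → Σ< (m ℕ.+ n) a ≈ Σ< m a + Σ< n (λ i → a (m ℕ.+ i))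
  Σ-split zero n a = sym (+-identityˡ _)
  Σ-split (suc m) n a = begin
    Σ< (suc (m ℕ.+ n)) a                                          ≈⟨ Σ-uncons (m ℕ.+ n) a ⟩
    a 0 + Σ< (m ℕ.+ n) (λ i → a (suc i))                          ≈⟨ +-congˡ (Σ-split m n (λ i → a (suc i))) ⟩
    a 0 + (Σ< m (λ i → a (suc i)) + Σ< n (λ i → a (suc m ℕ.+ i))) ≈⟨ +-assoc _ _ _ ⟨
    a 0 + Σ< m (λ i → a (suc i)) + Σ< n (λ i → a (suc m ℕ.+ i))   ≈⟨ +-congʳ (Σ-uncons m a) ⟨
    Σ< (suc m) a + Σ< n (λ i → a (suc m ℕ.+ i))                   ∎

  Σ-extend : ∀ m n (a : ℕ → Carrier) → m ℕ.≤ n → (∀ i → m ℕ.≤ i → i ℕ.< n → a i ≈ 0#) → Σ< n a ≈ Σ< m a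
  Σ-extend m n a m≤n beyond-m≈0 = begin
    Σ< n a                                     ≡⟨ ≡.cong (λ k → Σ< k a) (ℕₚ.m+[n∸m]≡n m≤n) ⟨
    Σ< (m ℕ.+ (n ℕ.∸ m)) a                     ≈⟨ Σ-split m (n ℕ.∸ m) a ⟩
    Σ< m a + Σ< (n ℕ.∸ m) (λ i → a (m ℕ.+ i))  ≈⟨ +-congˡ (Σ-≈0 (n ℕ.∸ m) beyond-m≈0′) ⟩
    Σ< m a + 0#                                ≈⟨ +-identityʳ _ ⟩
    Σ< m a                                     ∎
    where
    beyond-m≈0′ : ∀ i → i ℕ.< n ℕ.∸ m → a (m ℕ.+ i) ≈ 0#
    beyond-m≈0′ i i<n∸m = beyond-m≈0 (m ℕ.+ i) (ℕₚ.m≤m+n m i)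
      (≡.subst (m ℕ.+ i ℕ.<_) (ℕₚ.m+[n∸m]≡n m≤n) (ℕₚ.+-monoʳ-< m i<n∸m))

  Σ-comm : ∀ n m (a : ℕ → ℕ → Carrier) → Σ< n (λ i → Σ< m (a i)) ≈ Σ< m (λ j → Σ< n (λ i → a i j))
  Σ-comm zero m a = sym (Σ-≈0 m (λ _ _ → refl))
  Σ-comm (suc n) m a = trans (+-congʳ (Σ-comm n m a)) (sym (Σ-+ m (λ j → Σ< n (λ i → a i j)) (a n)))

  Σ-reverse : ∀ n (a : ℕ → Carrier) → Σ< n a ≈ Σ< n (λ i → a (n ℕ.∸ suc i))
  Σ-reverse zero a = refl
  Σ-reverse (suc n) a = begin
    Σ< n a + a n                          ≈⟨ +-congʳ (Σ-reverse n a) ⟩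
    Σ< n (λ i → a (n ℕ.∸ suc i)) + a n    ≈⟨ +-comm _ _ ⟩
    a n + Σ< n (λ i → a (n ℕ.∸ suc i))    ≈⟨ Σ-uncons n (λ i → a (suc n ℕ.∸ suc i)) ⟨
    Σ< (suc n) (λ i → a (suc n ℕ.∸ suc i)) ∎

  Σ-single : ∀ n j (a : ℕ → Carrier) → j ℕ.< n → (∀ i → i ℕ.< n → i ≢ j → a i ≈ 0#) → Σ< n a ≈ a j
  Σ-single (suc n) j a j<1+n others≈0 with j ℕ.≟ n
  ... | yes ≡.refl = trans (+-congʳ (Σ-≈0 n (λ i i<n → others≈0 i (ℕₚ.m<n⇒m<1+n i<n) (λ i≡n → ℕₚ.<-irrefl i≡n i<n))))
                           (+-identityˡ _)
  ... | no j≢n = trans (+-cong (Σ-single n j a (ℕₚ.≤∧≢⇒< (ℕₚ.≤-pred j<1+n) j≢n) (λ i i<n → others≈0 i (ℕₚ.m<n⇒m<1+n i<n)))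
                               (others≈0 n ℕₚ.≤-refl (λ n≡j → j≢n (≡.sym n≡j))))
                       (+-identityʳ _)

  Σ-triangle : ∀ n (a : ℕ → ℕ → Carrier) →
               Σ< n (λ i → Σ< (suc i) (a i)) ≈ Σ< n (λ j → Σ< (n ℕ.∸ j) (λ p → a (j ℕ.+ p) j))
  Σ-triangle zero a = refl
  Σ-triangle (suc n) a = begin
    Σ< n (λ i → Σ< (suc i) (a i)) + Σ< (suc n) (a n)   ≈⟨ +-congʳ (Σ-triangle n a) ⟩
    Σ< n column + Σ< (suc n) (a n)                     ≈⟨ +-congʳ (+-identityʳ _) ⟨
    Σ< n column + 0# + Σ< (suc n) (a n)                ≈⟨ +-congʳ (+-congˡ last≈0) ⟨
    Σ< (suc n) column + Σ< (suc n) (a n)               ≈⟨ Σ-+ (suc n) column (a n) ⟨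
    Σ< (suc n) (λ j → column j + a n j)                ≈⟨ Σ-cong< (suc n) extend ⟨
    Σ< (suc n) (λ j → Σ< (suc n ℕ.∸ j) (λ p → a (j ℕ.+ p) j)) ∎
    where
    column : ℕ → Carrier
    column j = Σ< (n ℕ.∸ j) (λ p → a (j ℕ.+ p) j)
    last≈0 : column n ≈ 0#
    last≈0 = ≡.subst (λ k → Σ< k (λ p → a (n ℕ.+ p) n) ≈ 0#) (≡.sym (ℕₚ.n∸n≡0 n)) refl
    extend : ∀ j → j ℕ.< suc n → Σ< (suc n ℕ.∸ j) (λ p → a (j ℕ.+ p) j) ≈ column j + a n j
    extend j j<1+n = begin
      Σ< (suc n ℕ.∸ j) (λ p → a (j ℕ.+ p) j)   ≡⟨ ≡.cong (λ k → Σ< k (λ p → a (j ℕ.+ p) j)) (ℕₚ.+-∸-assoc 1 (ℕₚ.≤-pred j<1+n)) ⟩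
      Σ< (suc (n ℕ.∸ j)) (λ p → a (j ℕ.+ p) j) ≡⟨ ≡.cong (λ k → column j + a k j) (ℕₚ.m+[n∸m]≡n (ℕₚ.≤-pred j<1+n)) ⟩
      column j + a n j                         ∎

module SeriesRing {c ℓ} (K : Field c ℓ) where
  open Field K hiding (zero)
  open FieldDefs K
  open FiniteSums K
  open SetoidReasoning setoid

  _+ₛ_ : Series → Series → Series
  (a +ₛ b) n = a n + b n

  -ₛ_ : Series → Series
  (-ₛ a) n = - a n

  0ₛ : Series
  0ₛ _ = 0#

  ≈ₛ-refl : ∀ {a} → a ≈ₛ a
  ≈ₛ-refl _ = refl

  ≈ₛ-sym : ∀ {a b} → a ≈ₛ b → b ≈ₛ a
  ≈ₛ-sym a≈b n = sym (a≈b n)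

  ≈ₛ-trans : ∀ {a b d} → a ≈ₛ b → b ≈ₛ d → a ≈ₛ d
  ≈ₛ-trans a≈b b≈d n = trans (a≈b n) (b≈d n)

  ⋆-cong : ∀ {a a′ b b′} → a ≈ₛ a′ → b ≈ₛ b′ → (a ⋆ b) ≈ₛ (a′ ⋆ b′)
  ⋆-cong a≈a′ b≈b′ n = Σ-cong (suc n) (λ i → *-cong (a≈a′ i) (b≈b′ (n ℕ.∸ i)))

  ⋆-congˡ : ∀ a {b b′} → b ≈ₛ b′ → (a ⋆ b) ≈ₛ (a ⋆ b′)
  ⋆-congˡ a b≈b′ = ⋆-cong {a} ≈ₛ-refl b≈b′

  ⋆-congʳ : ∀ b {a a′} → a ≈ₛ a′ → (a ⋆ b) ≈ₛ (a′ ⋆ b)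
  ⋆-congʳ b a≈a′ = ⋆-cong {b = b} a≈a′ ≈ₛ-refl

  ⋆-comm : ∀ a b → (a ⋆ b) ≈ₛ (b ⋆ a)
  ⋆-comm a b n = begin
    Σ< (suc n) (λ i → a i * b (n ℕ.∸ i))                    ≈⟨ Σ-reverse (suc n) _ ⟩
    Σ< (suc n) (λ i → a (n ℕ.∸ i) * b (n ℕ.∸ (n ℕ.∸ i)))    ≈⟨ Σ-cong< (suc n) swap ⟩
    Σ< (suc n) (λ i → b i * a (n ℕ.∸ i))                    ∎
    where
    swap : ∀ i → i ℕ.< suc n → a (n ℕ.∸ i) * b (n ℕ.∸ (n ℕ.∸ i)) ≈ b i * a (n ℕ.∸ i)
    swap i i≤n = trans (*-comm _ _) (*-congʳ (reflexive (≡.cong b (ℕₚ.m∸[m∸n]≡n (ℕₚ.≤-pred i≤n)))))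

  ⋆-identityˡ : ∀ a → (oneₛ ⋆ a) ≈ₛ a
  ⋆-identityˡ a n = trans (Σ-single (suc n) 0 _ (ℕ.s≤s ℕ.z≤n) others≈0) (*-identityˡ _)
    where
    others≈0 : ∀ i → i ℕ.< suc n → i ≢ 0 → oneₛ i * a (n ℕ.∸ i) ≈ 0#
    others≈0 zero    _ i≢0 = ⊥-elim (i≢0 ≡.refl)
    others≈0 (suc i) _ _   = zeroˡ _

  ⋆-identityʳ : ∀ a → (a ⋆ oneₛ) ≈ₛ a
  ⋆-identityʳ a = ≈ₛ-trans (⋆-comm a oneₛ) (⋆-identityˡ a)

  ⋆-distribˡ : ∀ a b d → (a ⋆ (b +ₛ d)) ≈ₛ ((a ⋆ b) +ₛ (a ⋆ d))
  ⋆-distribˡ a b d n = trans (Σ-cong (suc n) (λ i → distribˡ _ _ _)) (Σ-+ (suc n) _ _)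

  ⋆-distribʳ : ∀ a b d → ((b +ₛ d) ⋆ a) ≈ₛ ((b ⋆ a) +ₛ (d ⋆ a))
  ⋆-distribʳ a b d = ≈ₛ-trans (⋆-comm _ _)
    (≈ₛ-trans (⋆-distribˡ a b d) (λ n → +-cong (⋆-comm a b n) (⋆-comm a d n)))

  ⋆-assoc : ∀ a b d → ((a ⋆ b) ⋆ d) ≈ₛ (a ⋆ (b ⋆ d))
  ⋆-assoc a b d n = begin
    Σ< (suc n) (λ i → Σ< (suc i) (λ j → a j * b (i ℕ.∸ j)) * d (n ℕ.∸ i))
      ≈⟨ Σ-cong (suc n) (λ i → *-distribʳ-Σ (suc i) _ _) ⟩
    Σ< (suc n) (λ i → Σ< (suc i) (λ j → a j * b (i ℕ.∸ j) * d (n ℕ.∸ i)))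
      ≈⟨ Σ-triangle (suc n) _ ⟩
    Σ< (suc n) (λ j → Σ< (suc n ℕ.∸ j) (λ p → a j * b (j ℕ.+ p ℕ.∸ j) * d (n ℕ.∸ (j ℕ.+ p))))
      ≈⟨ Σ-cong< (suc n) inner ⟩
    Σ< (suc n) (λ j → a j * Σ< (suc (n ℕ.∸ j)) (λ p → b p * d (n ℕ.∸ j ℕ.∸ p)))
      ∎
    where
    reindex : ∀ j p → a j * b (j ℕ.+ p ℕ.∸ j) * d (n ℕ.∸ (j ℕ.+ p)) ≈ a j * (b p * d (n ℕ.∸ j ℕ.∸ p))
    reindex j p = trans (*-assoc _ _ _) (*-congˡ (*-cong (reflexive (≡.cong b (ℕₚ.m+n∸m≡n j p)))
                                                          (reflexive (≡.cong d (≡.sym (ℕₚ.∸-+-assoc n j p))))))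
    inner : ∀ j → j ℕ.< suc n →
            Σ< (suc n ℕ.∸ j) (λ p → a j * b (j ℕ.+ p ℕ.∸ j) * d (n ℕ.∸ (j ℕ.+ p))) ≈
            a j * Σ< (suc (n ℕ.∸ j)) (λ p → b p * d (n ℕ.∸ j ℕ.∸ p))
    inner j j≤n = begin
      Σ< (suc n ℕ.∸ j) (λ p → a j * b (j ℕ.+ p ℕ.∸ j) * d (n ℕ.∸ (j ℕ.+ p)))
        ≡⟨ ≡.cong (λ k → Σ< k (λ p → a j * b (j ℕ.+ p ℕ.∸ j) * d (n ℕ.∸ (j ℕ.+ p)))) (ℕₚ.+-∸-assoc 1 (ℕₚ.≤-pred j≤n)) ⟩
      Σ< (suc (n ℕ.∸ j)) (λ p → a j * b (j ℕ.+ p ℕ.∸ j) * d (n ℕ.∸ (j ℕ.+ p)))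
        ≈⟨ Σ-cong (suc (n ℕ.∸ j)) (reindex j) ⟩
      Σ< (suc (n ℕ.∸ j)) (λ p → a j * (b p * d (n ℕ.∸ j ℕ.∸ p)))
        ≈⟨ *-distribˡ-Σ (suc (n ℕ.∸ j)) _ _ ⟨
      a j * Σ< (suc (n ℕ.∸ j)) (λ p → b p * d (n ℕ.∸ j ℕ.∸ p))
        ∎

  seriesRing : CommutativeRing c ℓ
  seriesRing = record
    { Carrier = Series ; _≈_ = _≈ₛ_ ; _+_ = _+ₛ_ ; _*_ = _⋆_ ; -_ = -ₛ_ ; 0# = 0ₛ ; 1# = oneₛ
    ; isCommutativeRing = record
      { isRing = record
        { +-isAbelianGroup = record
          { isGroup = record
            { isMonoid = record
              { isSemigroup = record
                { isMagma = record
                  { isEquivalence = record { refl = ≈ₛ-refl ; sym = ≈ₛ-sym ; trans = ≈ₛ-trans }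
                  ; ∙-cong = λ a≈a′ b≈b′ n → +-cong (a≈a′ n) (b≈b′ n) }
                ; assoc = λ _ _ _ _ → +-assoc _ _ _ }
              ; identity = (λ _ _ → +-identityˡ _) , (λ _ _ → +-identityʳ _) }
            ; inverse = (λ _ _ → -‿inverseˡ _) , (λ _ _ → -‿inverseʳ _)
            ; ⁻¹-cong = λ a≈b n → -‿cong (a≈b n) }
          ; comm = λ _ _ _ → +-comm _ _ }
        ; *-cong = ⋆-cong
        ; *-assoc = ⋆-assoc
        ; *-identity = ⋆-identityˡ , ⋆-identityʳ
        ; distrib = ⋆-distribˡ , ⋆-distribʳ }
      ; *-comm = ⋆-comm } }

  module ≈ₛ-Reasoning = SetoidReasoning (CommutativeRing.setoid seriesRing)
  open CommutativeSemigroupProperties (CommutativeRing.*-commutativeSemigroup seriesRing) public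
    using (interchange; x∙yz≈y∙xz; xy∙z≈xz∙y; xy∙z≈zy∙x)

module Series {c ℓ} (K : Field c ℓ) where
  open Field K hiding (zero)
  open FieldDefs K
  open FieldProperties K
  open FiniteSums K
  open SeriesRing K
  open RingProperties ring using (+-cancelˡ; //-rightDividesˡ)
  module ≈-Reasoning = SetoidReasoning setoid

  shift : Series → Series
  shift a zero    = 0#
  shift a (suc n) = a n

  shift-cong : ∀ {a b} → a ≈ₛ b → shift a ≈ₛ shift b
  shift-cong a≈b zero    = refl
  shift-cong a≈b (suc n) = a≈b n

  t⋆≈shift : ∀ a → (tₛ ⋆ a) ≈ₛ shift a
  t⋆≈shift a zero    = trans (+-identityˡ _) (zeroˡ _)
  t⋆≈shift a (suc n) = trans (Σ-single (suc (suc n)) 1 _ (ℕ.s≤s (ℕ.s≤s ℕ.z≤n)) others≈0) (*-identityˡ _)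
    where
    others≈0 : ∀ i → i ℕ.< suc (suc n) → i ≢ 1 → tₛ i * a (suc n ℕ.∸ i) ≈ 0#
    others≈0 zero          _ _   = zeroˡ _
    others≈0 (suc zero)    _ i≢1 = ⊥-elim (i≢1 ≡.refl)
    others≈0 (suc (suc i)) _ _   = zeroˡ _

  t⋆-cancel : ∀ {a b} → (tₛ ⋆ a) ≈ₛ (tₛ ⋆ b) → a ≈ₛ b
  t⋆-cancel {a} {b} ta≈tb n = trans (sym (t⋆≈shift a (suc n))) (trans (ta≈tb (suc n)) (t⋆≈shift b (suc n)))

  ^ₛ-cong : ∀ {a b} n → a ≈ₛ b → (a ^ₛ n) ≈ₛ (b ^ₛ n)
  ^ₛ-cong zero    a≈b = ≈ₛ-refl
  ^ₛ-cong (suc n) a≈b = ⋆-cong a≈b (^ₛ-cong n a≈b)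

  ^ₛ-congʳ : ∀ a {m n} → m ≡ n → (a ^ₛ m) ≈ₛ (a ^ₛ n)
  ^ₛ-congʳ a ≡.refl = ≈ₛ-refl

  ^ₛ-distrib-⋆ : ∀ a b n → ((a ⋆ b) ^ₛ n) ≈ₛ ((a ^ₛ n) ⋆ (b ^ₛ n))
  ^ₛ-distrib-⋆ a b zero    = ≈ₛ-sym (⋆-identityˡ oneₛ)
  ^ₛ-distrib-⋆ a b (suc n) = ≈ₛ-trans (⋆-congˡ (a ⋆ b) (^ₛ-distrib-⋆ a b n)) (interchange a b (a ^ₛ n) (b ^ₛ n))

  ^ₛ-+ : ∀ a m n → ((a ^ₛ m) ⋆ (a ^ₛ n)) ≈ₛ (a ^ₛ (m ℕ.+ n))
  ^ₛ-+ a zero    n = ⋆-identityˡ _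
  ^ₛ-+ a (suc m) n = ≈ₛ-trans (⋆-assoc a (a ^ₛ m) (a ^ₛ n)) (⋆-congˡ a (^ₛ-+ a m n))

  ^ₛ-* : ∀ a m q → ((a ^ₛ m) ^ₛ q) ≈ₛ (a ^ₛ (q ℕ.* m))
  ^ₛ-* a m zero    = ≈ₛ-refl
  ^ₛ-* a m (suc q) = ≈ₛ-trans (⋆-congˡ (a ^ₛ m) (^ₛ-* a m q)) (^ₛ-+ a m (q ℕ.* m))

  oneₛ-^ₛ : ∀ n → (oneₛ ^ₛ n) ≈ₛ oneₛ
  oneₛ-^ₛ zero    = ≈ₛ-refl
  oneₛ-^ₛ (suc n) = ≈ₛ-trans (⋆-identityˡ _) (oneₛ-^ₛ n)

  tᵏ⋆-cancel : ∀ k {a b} → ((tₛ ^ₛ k) ⋆ a) ≈ₛ ((tₛ ^ₛ k) ⋆ b) → a ≈ₛ b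
  tᵏ⋆-cancel zero    {a} {b} a≈b = ≈ₛ-trans (≈ₛ-sym (⋆-identityˡ a)) (≈ₛ-trans a≈b (⋆-identityˡ b))
  tᵏ⋆-cancel (suc k) {a} {b} ta≈tb =
    tᵏ⋆-cancel k (t⋆-cancel (≈ₛ-trans (≈ₛ-sym (⋆-assoc tₛ (tₛ ^ₛ k) a)) (≈ₛ-trans ta≈tb (⋆-assoc tₛ (tₛ ^ₛ k) b))))

  δ : ℕ → Series
  δ k n with n ℕ.≟ k
  ... | yes _ = 1#
  ... | no  _ = 0#

  δ-diag : ∀ k → δ k k ≈ 1#
  δ-diag k with k ℕ.≟ k
  ... | yes _   = refl
  ... | no  k≢k = ⊥-elim (k≢k ≡.refl)

  δ-off : ∀ k n → n ≢ k → δ k n ≈ 0#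
  δ-off k n n≢k with n ℕ.≟ k
  ... | yes n≡k = ⊥-elim (n≢k n≡k)
  ... | no  _   = refl

  oneₛ≈δ0 : oneₛ ≈ₛ δ 0
  oneₛ≈δ0 zero    = sym (δ-diag 0)
  oneₛ≈δ0 (suc n) = sym (δ-off 0 (suc n) (λ ()))

  shift-δ : ∀ k → shift (δ k) ≈ₛ δ (suc k)
  shift-δ k zero    = sym (δ-off (suc k) 0 (λ ()))
  shift-δ k (suc n) with ℕₚ.<-cmp n k
  ... | tri≈ _ ≡.refl _ = trans (δ-diag n) (sym (δ-diag (suc n)))
  ... | tri< _ n≢k _    = trans (δ-off k n n≢k) (sym (δ-off (suc k) (suc n) (λ 1+n≡1+k → n≢k (ℕₚ.suc-injective 1+n≡1+k))))
  ... | tri> _ n≢k _    = trans (δ-off k n n≢k) (sym (δ-off (suc k) (suc n) (λ 1+n≡1+k → n≢k (ℕₚ.suc-injective 1+n≡1+k))))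

  tᵏ≈δ : ∀ k → (tₛ ^ₛ k) ≈ₛ δ k
  tᵏ≈δ zero    = oneₛ≈δ0
  tᵏ≈δ (suc k) = ≈ₛ-trans (t⋆≈shift _) (≈ₛ-trans (shift-cong (tᵏ≈δ k)) (shift-δ k))

  δ⋆δ : ∀ m k → (δ m ⋆ δ k) ≈ₛ δ (m ℕ.+ k)
  δ⋆δ m k = ≈ₛ-trans (⋆-cong (≈ₛ-sym (tᵏ≈δ m)) (≈ₛ-sym (tᵏ≈δ k))) (≈ₛ-trans (^ₛ-+ tₛ m k) (tᵏ≈δ (m ℕ.+ k)))

  ⋆-constant : ∀ a b → (a ⋆ b) 0 ≈ a 0 * b 0
  ⋆-constant a b = +-identityˡ _

  ⋆-constant-≉0 : ∀ a b → a 0 ≉ 0# → b 0 ≉ 0# → (a ⋆ b) 0 ≉ 0#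
  ⋆-constant-≉0 a b a0≉0 b0≉0 = ≉0-resp-≈ (sym (⋆-constant a b)) (*-≉0 a0≉0 b0≉0)

  ^ₛ-constant-≉0 : ∀ a n → a 0 ≉ 0# → (a ^ₛ n) 0 ≉ 0#
  ^ₛ-constant-≉0 a zero    a0≉0 = 1≉0
  ^ₛ-constant-≉0 a (suc n) a0≉0 = ⋆-constant-≉0 a (a ^ₛ n) a0≉0 (^ₛ-constant-≉0 a n a0≉0)

  Order≥ : ℕ → Series → Set ℓ
  Order≥ p a = ∀ n → n ℕ.< p → a n ≈ 0#

  Order≥-resp : ∀ p {a b} → a ≈ₛ b → Order≥ p a → Order≥ p b
  Order≥-resp p a≈b ord n n<p = trans (sym (a≈b n)) (ord n n<p)

  Order≥-⋆ : ∀ p a w → Order≥ p a → Order≥ p (a ⋆ w)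
  Order≥-⋆ p a w ord n n<p = Σ-≈0 (suc n) (λ i i≤n → trans (*-congʳ (ord i (ℕₚ.<-≤-trans i≤n n<p))) (zeroˡ _))

  Order≥-shift : ∀ p a → Order≥ p a → Order≥ (suc p) (shift a)
  Order≥-shift p a ord zero    _           = refl
  Order≥-shift p a ord (suc n) (ℕ.s≤s n<p) = ord n n<p

  ⋆-at-order : ∀ p a w → Order≥ p a → (a ⋆ w) p ≈ a p * w 0
  ⋆-at-order p a w ord = trans (Σ-single (suc p) p _ ℕₚ.≤-refl lower≈0) (*-congˡ (reflexive (≡.cong w (ℕₚ.n∸n≡0 p))))
    where
    lower≈0 : ∀ i → i ℕ.< suc p → i ≢ p → a i * w (p ℕ.∸ i) ≈ 0#
    lower≈0 i i≤p i≢p = trans (*-congʳ (ord i (ℕₚ.≤∧≢⇒< (ℕₚ.≤-pred i≤p) i≢p))) (zeroˡ _)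

  infixl 7 _▷_

  -- The product M v when M is lower triangular: only the entries M n k with k ≤ n are used.
  _▷_ : (ℕ → ℕ → Carrier) → Series → Series
  (M ▷ v) n = Σ< (suc n) (λ k → M n k * v k)

  ▷-congʳ : ∀ M {v v′} → v ≈ₛ v′ → (M ▷ v) ≈ₛ (M ▷ v′)
  ▷-congʳ M v≈v′ n = Σ-cong (suc n) (λ k → *-congˡ (v≈v′ k))

  LowerTriangular : (ℕ → ℕ → Carrier) → Set ℓ
  LowerTriangular M = ∀ n k → n ℕ.< k → M n k ≈ 0#

  NonzeroDiagonal : (ℕ → ℕ → Carrier) → Set ℓ
  NonzeroDiagonal M = ∀ n → M n n ≉ 0#

  module TriangularSystem (M : ℕ → ℕ → Carrier) (diag : NonzeroDiagonal M) (y : Series) where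

    private
      next : ℕ → Series → Carrier
      next n p = M n n ⁻¹[ diag n ] * (y n - Σ< n (λ k → M n k * p k))

      -- entries 0, …, n - 1 of the solution, so that the recursion is structural
      prefix : ℕ → Series
      prefix zero    k = 0#
      prefix (suc n) k with k ℕ.≟ n
      ... | yes _ = next n (prefix n)
      ... | no  _ = prefix n k

    solution : Series
    solution n = next n (prefix n)

    private
      prefix-solution : ∀ n k → k ℕ.< n → prefix n k ≡ solution k
      prefix-solution (suc n) k k≤n with k ℕ.≟ n
      ... | yes ≡.refl = ≡.refl
      ... | no  k≢n    = prefix-solution n k (ℕₚ.≤∧≢⇒< (ℕₚ.≤-pred k≤n) k≢n)

    solves : (M ▷ solution) ≈ₛ y
    solves n = begin
      S + M n n * (M n n ⁻¹[ diag n ] * (y n - S′))  ≈⟨ +-cong S≈S′ (sym (*-assoc _ _ _)) ⟩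
      S′ + M n n * M n n ⁻¹[ diag n ] * (y n - S′)   ≈⟨ +-congˡ (*-congʳ (⁻¹-inverseʳ _ (diag n))) ⟩
      S′ + 1# * (y n - S′)                           ≈⟨ +-congˡ (*-identityˡ _) ⟩
      S′ + (y n - S′)                                ≈⟨ +-comm _ _ ⟩
      y n - S′ + S′                                  ≈⟨ //-rightDividesˡ S′ (y n) ⟩
      y n                                            ∎
      where
      open ≈-Reasoning
      S  = Σ< n (λ k → M n k * solution k)
      S′ = Σ< n (λ k → M n k * prefix n k)
      S≈S′ : S ≈ S′
      S≈S′ = Σ-cong< n (λ k k<n → *-congˡ (reflexive (≡.sym (prefix-solution n k k<n))))

  ▷-injective : ∀ M → NonzeroDiagonal M → ∀ {u v} → (M ▷ u) ≈ₛ (M ▷ v) → u ≈ₛ v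
  ▷-injective M diag {u} {v} Mu≈Mv = <-rec (λ n → u n ≈ v n) step
    where
    step : ∀ n → (∀ {k} → k ℕ.< n → u k ≈ v k) → u n ≈ v n
    step n u≈v-below = *-cancelˡ-≉0 (M n n) (diag n)
      (+-cancelˡ _ _ _ (trans (Mu≈Mv n) (+-congʳ (Σ-cong< n (λ k k<n → *-congˡ (sym (u≈v-below k<n)))))))

  multiplication : Series → (ℕ → ℕ → Carrier)
  multiplication b n k with k ℕ.≤? n
  ... | yes _ = b (n ℕ.∸ k)
  ... | no  _ = 0#

  multiplication-≤ : ∀ b {n k} → k ℕ.≤ n → multiplication b n k ≈ b (n ℕ.∸ k)
  multiplication-≤ b {n} {k} k≤n with k ℕ.≤? n
  ... | yes _   = refl
  ... | no  k≰n = ⊥-elim (k≰n k≤n)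

  multiplication-lowerTriangular : ∀ b → LowerTriangular (multiplication b)
  multiplication-lowerTriangular b n k n<k with k ℕ.≤? n
  ... | yes k≤n = ⊥-elim (ℕₚ.<⇒≱ n<k k≤n)
  ... | no  _   = refl

  multiplication-nonzeroDiagonal : ∀ b → b 0 ≉ 0# → NonzeroDiagonal (multiplication b)
  multiplication-nonzeroDiagonal b b0≉0 n =
    ≉0-resp-≈ (sym (trans (multiplication-≤ b {n} ℕₚ.≤-refl) (reflexive (≡.cong b (ℕₚ.n∸n≡0 n))))) b0≉0

  multiplication-▷ : ∀ b a → (multiplication b ▷ a) ≈ₛ (a ⋆ b)
  multiplication-▷ b a n = Σ-cong< (suc n) (λ k k≤n → trans (*-congʳ (multiplication-≤ b (ℕₚ.≤-pred k≤n))) (*-comm _ _))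

  module Inverse (b : Series) (b0≉0 : b 0 ≉ 0#) where
    open TriangularSystem (multiplication b) (multiplication-nonzeroDiagonal b b0≉0) oneₛ public
      using () renaming (solution to b⁻¹; solves to b⁻¹-solves)

    b⁻¹-inverseʳ : (b ⋆ b⁻¹) ≈ₛ oneₛ
    b⁻¹-inverseʳ = ≈ₛ-trans (⋆-comm b b⁻¹) (≈ₛ-trans (≈ₛ-sym (multiplication-▷ b b⁻¹)) b⁻¹-solves)

    b⁻¹-inverseˡ : (b⁻¹ ⋆ b) ≈ₛ oneₛ
    b⁻¹-inverseˡ = ≈ₛ-trans (⋆-comm b⁻¹ b) b⁻¹-inverseʳ

    b⁻¹-constant-≉0 : b⁻¹ 0 ≉ 0#
    b⁻¹-constant-≉0 b⁻¹0≈0 = 1≉0 (trans (sym (b⁻¹-inverseʳ 0)) (trans (⋆-constant b b⁻¹) (trans (*-congˡ b⁻¹0≈0) (zeroʳ _))))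

    b⋆-cancel : ∀ {x y} → (b ⋆ x) ≈ₛ (b ⋆ y) → x ≈ₛ y
    b⋆-cancel {x} {y} bx≈by = begin
      x                ≈⟨ ⋆-identityˡ x ⟨
      oneₛ ⋆ x         ≈⟨ ⋆-congʳ x b⁻¹-inverseˡ ⟨
      (b⁻¹ ⋆ b) ⋆ x    ≈⟨ ⋆-assoc b⁻¹ b x ⟩
      b⁻¹ ⋆ (b ⋆ x)    ≈⟨ ⋆-congˡ b⁻¹ bx≈by ⟩
      b⁻¹ ⋆ (b ⋆ y)    ≈⟨ ⋆-assoc b⁻¹ b y ⟨
      (b⁻¹ ⋆ b) ⋆ y    ≈⟨ ⋆-congʳ y b⁻¹-inverseˡ ⟩
      oneₛ ⋆ y         ≈⟨ ⋆-identityˡ y ⟩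
      y                ∎
      where open ≈ₛ-Reasoning

  inverse-unique : ∀ a {x y} → (a ⋆ x) ≈ₛ oneₛ → (a ⋆ y) ≈ₛ oneₛ → x ≈ₛ y
  inverse-unique a {x} {y} ax≈1 ay≈1 = begin
    x                ≈⟨ ⋆-identityʳ x ⟨
    x ⋆ oneₛ         ≈⟨ ⋆-congˡ x ay≈1 ⟨
    x ⋆ (a ⋆ y)      ≈⟨ ⋆-assoc x a y ⟨
    (x ⋆ a) ⋆ y      ≈⟨ ⋆-congʳ y (≈ₛ-trans (⋆-comm x a) ax≈1) ⟩
    oneₛ ⋆ y         ≈⟨ ⋆-identityˡ y ⟩
    y                ∎
    where open ≈ₛ-Reasoning

  ·ₙ-cong : ∀ n {x y} → x ≈ y → (n ·ₙ x) ≈ (n ·ₙ y)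
  ·ₙ-cong zero    x≈y = refl
  ·ₙ-cong (suc n) x≈y = +-cong x≈y (·ₙ-cong n x≈y)

  ·ₙ-zero : ∀ n → (n ·ₙ 0#) ≈ 0#
  ·ₙ-zero zero    = refl
  ·ₙ-zero (suc n) = trans (+-identityˡ _) (·ₙ-zero n)

  ·ₙ-assocˡ : ∀ n x y → (n ·ₙ (x * y)) ≈ ((n ·ₙ x) * y)
  ·ₙ-assocˡ zero    x y = sym (zeroˡ y)
  ·ₙ-assocˡ (suc n) x y = trans (+-congˡ (·ₙ-assocˡ n x y)) (sym (distribʳ y x (n ·ₙ x)))

  ·ₙ-assocʳ : ∀ n x y → (n ·ₙ (x * y)) ≈ (x * (n ·ₙ y))
  ·ₙ-assocʳ zero    x y = sym (zeroʳ x)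
  ·ₙ-assocʳ (suc n) x y = trans (+-congˡ (·ₙ-assocʳ n x y)) (sym (distribˡ x y (n ·ₙ y)))

  ·ₙ-distrib-+ : ∀ n x y → (n ·ₙ (x + y)) ≈ ((n ·ₙ x) + (n ·ₙ y))
  ·ₙ-distrib-+ zero    x y = sym (+-identityʳ 0#)
  ·ₙ-distrib-+ (suc n) x y = trans (+-congˡ (·ₙ-distrib-+ n x y)) (+-interchange x y (n ·ₙ x) (n ·ₙ y))
    where open CommutativeSemigroupProperties +-commutativeSemigroup using () renaming (interchange to +-interchange)

  ·ₙ-homo-+ : ∀ m n x → ((m ℕ.+ n) ·ₙ x) ≈ ((m ·ₙ x) + (n ·ₙ x))
  ·ₙ-homo-+ zero    n x = sym (+-identityˡ _)
  ·ₙ-homo-+ (suc m) n x = trans (+-congˡ (·ₙ-homo-+ m n x)) (sym (+-assoc _ _ _))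

  ·ₙ-distrib-Σ : ∀ n m a → (n ·ₙ Σ< m a) ≈ Σ< m (λ i → n ·ₙ a i)
  ·ₙ-distrib-Σ n zero    a = ·ₙ-zero n
  ·ₙ-distrib-Σ n (suc m) a = trans (·ₙ-distrib-+ n _ _) (+-congʳ (·ₙ-distrib-Σ n m a))

  ·ₙ≈·ₙ1* : ∀ n x → (n ·ₙ x) ≈ ((n ·ₙ 1#) * x)
  ·ₙ≈·ₙ1* n x = trans (·ₙ-cong n (sym (*-identityˡ x))) (·ₙ-assocˡ n 1# x)

  ·ₙ-cancel : CharZero → ∀ n {x} → (suc n ·ₙ x) ≈ 0# → x ≈ 0#
  ·ₙ-cancel charZero n {x} nx≈0 = x*y≈0⇒y≈0 (suc n ·ₙ 1#) (charZero n) (trans (sym (·ₙ≈·ₙ1* (suc n) x)) nx≈0)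

  _·ₛ_ : ℕ → Series → Series
  (n ·ₛ a) k = n ·ₙ a k

  ·ₛ-cong : ∀ n {a b} → a ≈ₛ b → (n ·ₛ a) ≈ₛ (n ·ₛ b)
  ·ₛ-cong n a≈b k = ·ₙ-cong n (a≈b k)

  ⋆-·ₛ : ∀ n a b → (a ⋆ (n ·ₛ b)) ≈ₛ (n ·ₛ (a ⋆ b))
  ⋆-·ₛ n a b k = trans (Σ-cong (suc k) (λ i → sym (·ₙ-assocʳ n _ _))) (sym (·ₙ-distrib-Σ n (suc k) _))

  deriv-cong : ∀ {a b} → a ≈ₛ b → deriv a ≈ₛ deriv b
  deriv-cong a≈b n = ·ₙ-cong (suc n) (a≈b (suc n))

  deriv-t : deriv tₛ ≈ₛ oneₛ
  deriv-t zero    = +-identityʳ 1#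
  deriv-t (suc n) = ·ₙ-zero (suc (suc n))

  -- Both sums are reindexed to run over the coefficients a i b (n + 1 - i), whose weights i and n + 1 - i add up to n + 1.
  deriv-⋆ : ∀ a b → deriv (a ⋆ b) ≈ₛ ((deriv a ⋆ b) +ₛ (a ⋆ deriv b))
  deriv-⋆ a b n = sym (begin
    Σ< (suc n) (λ i → (suc i ·ₙ a (suc i)) * b (n ℕ.∸ i)) + Σ< (suc n) (λ i → a i * (suc (n ℕ.∸ i) ·ₙ b (suc (n ℕ.∸ i))))
      ≈⟨ +-cong (Σ-cong (suc n) (λ i → sym (·ₙ-assocˡ (suc i) _ _))) (Σ-cong< (suc n) right) ⟩
    Σ< (suc n) (λ i → suc i ·ₙ f (suc i)) + Σ< (suc n) (λ i → (suc n ℕ.∸ i) ·ₙ f i)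
      ≈⟨ +-cong (trans (sym (+-identityˡ _)) (sym (Σ-uncons (suc n) (λ i → i ·ₙ f i)))) (trans (sym (+-identityʳ _)) (+-congˡ last≈0)) ⟩
    Σ< (suc (suc n)) (λ i → i ·ₙ f i) + Σ< (suc (suc n)) (λ i → (suc n ℕ.∸ i) ·ₙ f i)
      ≈⟨ Σ-+ (suc (suc n)) _ _ ⟨
    Σ< (suc (suc n)) (λ i → (i ·ₙ f i) + ((suc n ℕ.∸ i) ·ₙ f i))
      ≈⟨ Σ-cong< (suc (suc n)) (λ i i≤1+n → trans (sym (·ₙ-homo-+ i (suc n ℕ.∸ i) (f i)))
                                                (reflexive (≡.cong (_·ₙ f i) (ℕₚ.m+[n∸m]≡n (ℕₚ.≤-pred i≤1+n))))) ⟩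
    Σ< (suc (suc n)) (λ i → suc n ·ₙ f i)
      ≈⟨ ·ₙ-distrib-Σ (suc n) (suc (suc n)) f ⟨
    suc n ·ₙ Σ< (suc (suc n)) f ∎)
    where
    open ≈-Reasoning
    f : ℕ → Carrier
    f i = a i * b (suc n ℕ.∸ i)
    1+n∸i : ∀ i → i ℕ.≤ n → suc n ℕ.∸ i ≡ suc (n ℕ.∸ i)
    1+n∸i i i≤n = ℕₚ.+-∸-assoc 1 i≤n
    right : ∀ i → i ℕ.< suc n → a i * (suc (n ℕ.∸ i) ·ₙ b (suc (n ℕ.∸ i))) ≈ (suc n ℕ.∸ i) ·ₙ f i
    right i i≤n = trans (sym (·ₙ-assocʳ (suc (n ℕ.∸ i)) (a i) _))
      (reflexive (≡.cong₂ (λ m j → m ·ₙ (a i * b j)) (≡.sym (1+n∸i i (ℕₚ.≤-pred i≤n))) (≡.sym (1+n∸i i (ℕₚ.≤-pred i≤n)))))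
    last≈0 : 0# ≈ (suc n ℕ.∸ suc n) ·ₙ f (suc n)
    last≈0 = sym (reflexive (≡.cong (λ m → m ·ₙ f (suc n)) (ℕₚ.n∸n≡0 n)))

  deriv-^ₛ : ∀ h n → deriv (h ^ₛ suc n) ≈ₛ (suc n ·ₛ ((h ^ₛ n) ⋆ deriv h))
  deriv-^ₛ h zero = begin
    deriv (h ⋆ oneₛ)          ≈⟨ deriv-cong (⋆-identityʳ h) ⟩
    deriv h                   ≈⟨ ⋆-identityˡ (deriv h) ⟨
    oneₛ ⋆ deriv h            ≈⟨ (λ _ → +-identityʳ _) ⟨
    1 ·ₛ (oneₛ ⋆ deriv h)     ∎
    where open ≈ₛ-Reasoning
  deriv-^ₛ h (suc n) = begin
    deriv (h ⋆ (h ^ₛ suc n))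
      ≈⟨ deriv-⋆ h (h ^ₛ suc n) ⟩
    (deriv h ⋆ (h ^ₛ suc n)) +ₛ (h ⋆ deriv (h ^ₛ suc n))
      ≈⟨ (λ k → +-cong (⋆-comm (deriv h) (h ^ₛ suc n) k) (⋆-congˡ h (deriv-^ₛ h n) k)) ⟩
    ((h ^ₛ suc n) ⋆ deriv h) +ₛ (h ⋆ (suc n ·ₛ ((h ^ₛ n) ⋆ deriv h)))
      ≈⟨ (λ k → +-congˡ (trans (⋆-·ₛ (suc n) h ((h ^ₛ n) ⋆ deriv h) k) (·ₙ-cong (suc n) (sym (⋆-assoc h (h ^ₛ n) (deriv h) k))))) ⟩
    suc (suc n) ·ₛ ((h ^ₛ suc n) ⋆ deriv h)
      ∎
    where open ≈ₛ-Reasoning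

  tail : Series → Series
  tail a n = a (suc n)

  tail-constant : ∀ a → deriv a 0 ≈ tail a 0
  tail-constant a = +-identityʳ _

  ≈t⋆tail : ∀ {a} → InTK a → a ≈ₛ (tₛ ⋆ tail a)
  ≈t⋆tail {a} (w , a≈tw) zero    = trans (trans (a≈tw 0) (t⋆≈shift w 0)) (sym (t⋆≈shift (tail a) 0))
  ≈t⋆tail {a} _          (suc n) = sym (t⋆≈shift (tail a) (suc n))

module SeriesInKtl {c ℓ} (K : Field c ℓ) (L : ℕ) .{{_ : NonZero L}} where
  open Field K hiding (zero)
  open FieldDefs K
  open WithL L
  open FieldProperties K
  open FiniteSums K
  open SeriesRing K
  open Series K

  Homogeneous : ℕ → Series → Set ℓ
  Homogeneous r a = ∀ n → n % L ≢ r % L → a n ≈ 0#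

  private
    %-cong-+ : ∀ {m m′ k k′} → m % L ≡ m′ % L → k % L ≡ k′ % L → (m ℕ.+ k) % L ≡ (m′ ℕ.+ k′) % L
    %-cong-+ {m} {m′} {k} {k′} m≡m′ k≡k′ =
      ≡.trans (%-distribˡ-+ m k L) (≡.trans (≡.cong₂ (λ x y → (x ℕ.+ y) % L) m≡m′ k≡k′) (≡.sym (%-distribˡ-+ m′ k′ L)))

    ∣⇔%≡0%L : ∀ {n} → L ∣ n → n % L ≡ 0 % L
    ∣⇔%≡0%L {n} L∣n = ≡.trans (n∣m⇒m%n≡0 n L L∣n) (≡.sym (m*n%n≡0 0 L))

    %≡0%L⇒∣ : ∀ {n} → n % L ≡ 0 % L → L ∣ n
    %≡0%L⇒∣ {n} n≡0 = m%n≡0⇒n∣m n L (≡.trans n≡0 (m*n%n≡0 0 L))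

  InKtl⇒Homogeneous : ∀ {a} → InKtl a → Homogeneous 0 a
  InKtl⇒Homogeneous a∈ n n≢0 = a∈ n (λ L∣n → n≢0 (∣⇔%≡0%L L∣n))

  Homogeneous⇒InKtl : ∀ {r a} → L ∣ r → Homogeneous r a → InKtl a
  Homogeneous⇒InKtl L∣r a∈ n L∤n = a∈ n (λ n≡r → L∤n (%≡0%L⇒∣ (≡.trans n≡r (∣⇔%≡0%L L∣r))))

  Homogeneous-resp : ∀ r {a b} → a ≈ₛ b → Homogeneous r a → Homogeneous r b
  Homogeneous-resp r a≈b a∈ n n≢r = trans (sym (a≈b n)) (a∈ n n≢r)

  Homogeneous-⋆ : ∀ r s a b → Homogeneous r a → Homogeneous s b → Homogeneous (r ℕ.+ s) (a ⋆ b)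
  Homogeneous-⋆ r s a b a∈ b∈ n n≢r+s = Σ-≈0 (suc n) term≈0
    where
    term≈0 : ∀ i → i ℕ.< suc n → a i * b (n ℕ.∸ i) ≈ 0#
    term≈0 i i≤n with i % L ℕ.≟ r % L | (n ℕ.∸ i) % L ℕ.≟ s % L
    ... | no  i≢r | _         = trans (*-congʳ (a∈ i i≢r)) (zeroˡ _)
    ... | yes _   | no  n-i≢s = trans (*-congˡ (b∈ _ n-i≢s)) (zeroʳ _)
    ... | yes i≡r | yes n-i≡s = ⊥-elim (n≢r+s (≡.trans (≡.cong (_% L) (≡.sym (ℕₚ.m+[n∸m]≡n (ℕₚ.≤-pred i≤n)))) (%-cong-+ i≡r n-i≡s)))

  Homogeneous-shift : ∀ r a → Homogeneous r a → Homogeneous (suc r) (shift a)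
  Homogeneous-shift r a a∈ zero    _       = refl
  Homogeneous-shift r a a∈ (suc n) n+1≢r+1 = a∈ n (λ n≡r → n+1≢r+1 (%-cong-+ {1} {1} ≡.refl n≡r))

  InKtl-oneₛ : InKtl oneₛ
  InKtl-oneₛ zero    L∤0 = ⊥-elim (L∤0 (%≡0%L⇒∣ ≡.refl))
  InKtl-oneₛ (suc n) _   = refl

  InKtl-resp : ∀ {a b} → a ≈ₛ b → InKtl a → InKtl b
  InKtl-resp a≈b a∈ n L∤n = trans (sym (a≈b n)) (a∈ n L∤n)

  InKtl-⋆ : ∀ {a b} → InKtl a → InKtl b → InKtl (a ⋆ b)
  InKtl-⋆ {a} {b} a∈ b∈ = Homogeneous⇒InKtl (L ∣0) (Homogeneous-⋆ 0 0 a b (InKtl⇒Homogeneous a∈) (InKtl⇒Homogeneous b∈))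

  InKtl-prodFin : ∀ {m} (s : Fin m → Series) → (∀ i → InKtl (s i)) → InKtl (prodFin s)
  InKtl-prodFin {zero}  s s∈ = InKtl-oneₛ
  InKtl-prodFin {suc m} s s∈ = InKtl-⋆ (s∈ Fin.zero) (InKtl-prodFin (λ i → s (Fin.suc i)) (λ i → s∈ (Fin.suc i)))

  GradePreserving : (ℕ → ℕ → Carrier) → Set ℓ
  GradePreserving M = ∀ n k → L ∣ k → ¬ (L ∣ n) → M n k ≈ 0#

  ▷-InKtl : ∀ M {v} → GradePreserving M → InKtl v → InKtl (M ▷ v)
  ▷-InKtl M {v} M-grade v∈ n L∤n = Σ-≈0 (suc n) term≈0
    where
    term≈0 : ∀ k → k ℕ.< suc n → M n k * v k ≈ 0#
    term≈0 k _ with L ∣? k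
    ... | yes L∣k = trans (*-congʳ (M-grade n k L∣k L∤n)) (zeroˡ _)
    ... | no  L∤k = trans (*-congˡ (v∈ k L∤k)) (zeroʳ _)

  ▷-InKtl-reflect : ∀ M {x} → NonzeroDiagonal M → GradePreserving M → InKtl (M ▷ x) → InKtl x
  ▷-InKtl-reflect M {x} diag M-grade Mx∈ n = <-rec (λ n → ¬ (L ∣ n) → x n ≈ 0#) step n
    where
    step : ∀ n → (∀ {k} → k ℕ.< n → ¬ (L ∣ k) → x k ≈ 0#) → ¬ (L ∣ n) → x n ≈ 0#
    step n x∈-below L∤n = x*y≈0⇒y≈0 (M n n) (diag n)
      (trans (sym (+-identityˡ _)) (trans (+-congʳ (sym (Σ-≈0 n term≈0))) (Mx∈ n L∤n)))
      where
      term≈0 : ∀ k → k ℕ.< n → M n k * x k ≈ 0#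
      term≈0 k k<n with L ∣? k
      ... | yes L∣k = trans (*-congʳ (M-grade n k L∣k L∤n)) (zeroˡ _)
      ... | no  L∤k = trans (*-congˡ (x∈-below k<n L∤k)) (zeroʳ _)

  ▷-cong-InKtl : ∀ M N {v} → (∀ n k → L ∣ k → M n k ≈ N n k) → InKtl v → (M ▷ v) ≈ₛ (N ▷ v)
  ▷-cong-InKtl M N {v} M≈N v∈ n = Σ-cong (suc n) term
    where
    term : ∀ k → M n k * v k ≈ N n k * v k
    term k with L ∣? k
    ... | yes L∣k = *-congʳ (M≈N n k L∣k)
    ... | no  L∤k = trans (*-congˡ (v∈ k L∤k)) (trans (zeroʳ _) (sym (trans (*-congˡ (v∈ k L∤k)) (zeroʳ _))))

  multiplication-gradePreserving : ∀ {b} → InKtl b → GradePreserving (multiplication b)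
  multiplication-gradePreserving {b} b∈ n k L∣k L∤n with k ℕ.≤? n
  ... | yes k≤n = b∈ (n ℕ.∸ k) (λ L∣n-k → L∤n (≡.subst (L ∣_) (ℕₚ.m∸n+n≡m k≤n) (∣m∣n⇒∣m+n L∣n-k L∣k)))
  ... | no  _   = refl

  InKtl-inverse : ∀ {b} (b0≉0 : b 0 ≉ 0#) → InKtl b → InKtl (Inverse.b⁻¹ b b0≉0)
  InKtl-inverse {b} b0≉0 b∈ = ▷-InKtl-reflect (multiplication b) (multiplication-nonzeroDiagonal b b0≉0)
    (multiplication-gradePreserving b∈) (InKtl-resp (≈ₛ-sym (Inverse.b⁻¹-solves b b0≉0)) InKtl-oneₛ)

  InKtl-tail : CharZero → ∀ {a} → InKtl (deriv a) → InKtl (tail a)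
  InKtl-tail charZero a′∈ n L∤n = ·ₙ-cancel charZero n (a′∈ n L∤n)

module InfiniteMatrices {c ℓ} (K : Field c ℓ) (L : ℕ) .{{_ : NonZero L}} where
  open Field K hiding (zero)
  open FieldDefs K
  open WithL L
  open FiniteSums K
  open SeriesRing K
  open Series K

  column : Matrix → ℕ → Series
  column M k n = M n k

  ≈ₘ-refl : ∀ {A} → A ≈ₘ A
  ≈ₘ-refl _ _ = refl

  ≈ₘ-sym : ∀ {A B} → A ≈ₘ B → B ≈ₘ A
  ≈ₘ-sym A≈B n k = sym (A≈B n k)

  ≈ₘ-trans : ∀ {A B C} → A ≈ₘ B → B ≈ₘ C → A ≈ₘ C
  ≈ₘ-trans A≈B B≈C n k = trans (A≈B n k) (B≈C n k)

  ≈ₘ-setoid : Setoid c ℓ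
  ≈ₘ-setoid = record { Carrier = Matrix ; _≈_ = _≈ₘ_
                     ; isEquivalence = record { refl = λ {A} → ≈ₘ-refl {A} ; sym = ≈ₘ-sym ; trans = ≈ₘ-trans } }

  module ≈ₘ-Reasoning = SetoidReasoning ≈ₘ-setoid

  ▷-congˡ : ∀ {M M′} v → M ≈ₘ M′ → (M ▷ v) ≈ₛ (M′ ▷ v)
  ▷-congˡ v M≈M′ n = Σ-cong (suc n) (λ k → *-congʳ (M≈M′ n k))

  ·ₘ-cong : ∀ {A A′ B B′} → A ≈ₘ A′ → B ≈ₘ B′ → (A ·ₘ B) ≈ₘ (A′ ·ₘ B′)
  ·ₘ-cong {A′ = A′} {B} A≈A′ B≈B′ n j =
    trans (▷-congˡ (column B j) A≈A′ n) (▷-congʳ A′ (λ k → B≈B′ k j) n)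

  ·ₘ-congˡ : ∀ {A A′} B → A ≈ₘ A′ → (A ·ₘ B) ≈ₘ (A′ ·ₘ B)
  ·ₘ-congˡ B A≈A′ = ·ₘ-cong A≈A′ (≈ₘ-refl {B})

  ·ₘ-congʳ : ∀ A {B B′} → B ≈ₘ B′ → (A ·ₘ B) ≈ₘ (A ·ₘ B′)
  ·ₘ-congʳ A B≈B′ = ·ₘ-cong (≈ₘ-refl {A}) B≈B′

  ▷-extend : ∀ M v → LowerTriangular M → ∀ {n m} → n ℕ.≤ m → Σ< (suc m) (λ k → M n k * v k) ≈ (M ▷ v) n
  ▷-extend M v M-lower {n} {m} n≤m =
    Σ-extend (suc n) (suc m) _ (ℕ.s≤s n≤m) (λ i n<i _ → trans (*-congʳ (M-lower n i n<i)) (zeroˡ _))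

  ▷-assoc : ∀ A B v → LowerTriangular B → (A ▷ (B ▷ v)) ≈ₛ ((A ·ₘ B) ▷ v)
  ▷-assoc A B v B-lower n = begin
    Σ< (suc n) (λ p → A n p * Σ< (suc p) (λ k → B p k * v k))
      ≈⟨ Σ-cong< (suc n) (λ p p≤n → *-congˡ (sym (▷-extend B v B-lower (ℕₚ.≤-pred p≤n)))) ⟩
    Σ< (suc n) (λ p → A n p * Σ< (suc n) (λ k → B p k * v k))
      ≈⟨ Σ-cong (suc n) (λ p → *-distribˡ-Σ (suc n) _ _) ⟩
    Σ< (suc n) (λ p → Σ< (suc n) (λ k → A n p * (B p k * v k)))
      ≈⟨ Σ-comm (suc n) (suc n) _ ⟩
    Σ< (suc n) (λ k → Σ< (suc n) (λ p → A n p * (B p k * v k)))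
      ≈⟨ Σ-cong (suc n) (λ k → trans (Σ-cong (suc n) (λ p → sym (*-assoc _ _ _))) (sym (*-distribʳ-Σ (suc n) _ _))) ⟩
    Σ< (suc n) (λ k → Σ< (suc n) (λ p → A n p * B p k) * v k)
      ∎
    where open SetoidReasoning setoid

  ·ₘ-assoc : ∀ A B C → LowerTriangular B → ((A ·ₘ B) ·ₘ C) ≈ₘ (A ·ₘ (B ·ₘ C))
  ·ₘ-assoc A B C B-lower n j = sym (▷-assoc A B (column C j) B-lower n)

  ·ₘ-lowerTriangular : ∀ A B → LowerTriangular B → LowerTriangular (A ·ₘ B)
  ·ₘ-lowerTriangular A B B-lower n j n<j =
    Σ-≈0 (suc n) (λ k k≤n → trans (*-congˡ (B-lower k j (ℕₚ.<-≤-trans k≤n n<j))) (zeroʳ _))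

  Iₘ≈δ : ∀ n k → Iₘ n k ≈ δ k n
  Iₘ≈δ n k with n ℕ.≟ k
  ... | yes _ = refl
  ... | no  _ = refl

  ▷δ : ∀ M k → LowerTriangular M → (M ▷ δ k) ≈ₛ column M k
  ▷δ M k M-lower n with k ℕ.≤? n
  ... | yes k≤n = trans (Σ-single (suc n) k _ (ℕ.s≤s k≤n) (λ i _ i≢k → trans (*-congˡ (δ-off k i i≢k)) (zeroʳ _)))
                        (trans (*-congˡ (δ-diag k)) (*-identityʳ _))
  ... | no  k≰n = trans (Σ-≈0 (suc n) (λ i i≤n → trans (*-congˡ (δ-off k i (i≢k i i≤n))) (zeroʳ _)))
                        (sym (M-lower n k (ℕₚ.≰⇒> k≰n)))
    where
    i≢k : ∀ i → i ℕ.< suc n → i ≢ k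
    i≢k i i≤n i≡k = k≰n (≡.subst (ℕ._≤ n) i≡k (ℕₚ.≤-pred i≤n))

  Iₘ-▷ : ∀ v → (Iₘ ▷ v) ≈ₛ v
  Iₘ-▷ v n = trans (Σ-single (suc n) n _ ℕₚ.≤-refl off-diagonal≈0) (trans (*-congʳ (trans (Iₘ≈δ n n) (δ-diag n))) (*-identityˡ _))
    where
    off-diagonal≈0 : ∀ i → i ℕ.< suc n → i ≢ n → Iₘ n i * v i ≈ 0#
    off-diagonal≈0 i _ i≢n = trans (*-congʳ (trans (Iₘ≈δ n i) (δ-off i n (λ n≡i → i≢n (≡.sym n≡i))))) (zeroˡ _)

  ·ₘ-identityˡ : ∀ M → (Iₘ ·ₘ M) ≈ₘ M
  ·ₘ-identityˡ M n j = Iₘ-▷ (column M j) n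

  ·ₘ-identityʳ : ∀ M → LowerTriangular M → (M ·ₘ Iₘ) ≈ₘ M
  ·ₘ-identityʳ M M-lower n j = trans (▷-congʳ M (λ k → Iₘ≈δ k j) n) (▷δ M j M-lower n)

  multiplication-column : ∀ b m → column (multiplication b) m ≈ₛ (δ m ⋆ b)
  multiplication-column b m = ≈ₛ-trans (≈ₛ-sym (▷δ (multiplication b) m (multiplication-lowerTriangular b))) (multiplication-▷ b (δ m))

  ▷-⋆ : ∀ M a b → (M ▷ (a ⋆ b)) ≈ₛ ((M ·ₘ multiplication b) ▷ a)
  ▷-⋆ M a b = ≈ₛ-trans (▷-congʳ M (≈ₛ-sym (multiplication-▷ b a))) (▷-assoc M (multiplication b) a (multiplication-lowerTriangular b))

  ⋆-▷ : ∀ M a b → LowerTriangular M → ((M ▷ a) ⋆ b) ≈ₛ ((multiplication b ·ₘ M) ▷ a)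
  ⋆-▷ M a b M-lower = ≈ₛ-trans (≈ₛ-sym (multiplication-▷ b (M ▷ a))) (▷-assoc (multiplication b) M a M-lower)

  leftInverse≈rightInverse : ∀ N R B → LowerTriangular N → LowerTriangular R →
                             (N ·ₘ R) ≈ₘ Iₘ → (R ·ₘ B) ≈ₘ Iₘ → N ≈ₘ B
  leftInverse≈rightInverse N R B N-lower R-lower NR≈I RB≈I = begin
    N                  ≈⟨ ·ₘ-identityʳ N N-lower ⟨
    N ·ₘ Iₘ            ≈⟨ ·ₘ-congʳ N RB≈I ⟨
    N ·ₘ (R ·ₘ B)      ≈⟨ ·ₘ-assoc N R B R-lower ⟨
    (N ·ₘ R) ·ₘ B      ≈⟨ ·ₘ-congˡ B NR≈I ⟩
    Iₘ ·ₘ B            ≈⟨ ·ₘ-identityˡ B ⟩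
    B                  ∎
    where open ≈ₘ-Reasoning

  rightInverse⇒leftInverse : ∀ A X Y → LowerTriangular A → LowerTriangular X →
                             (A ·ₘ X) ≈ₘ Iₘ → (X ·ₘ Y) ≈ₘ Iₘ → (X ·ₘ A) ≈ₘ Iₘ
  rightInverse⇒leftInverse A X Y A-lower X-lower AX≈I XY≈I =
    ≈ₘ-trans (·ₘ-congʳ X (leftInverse≈rightInverse A X Y A-lower X-lower AX≈I XY≈I)) XY≈I

module ColumnExponents {c ℓ} (K : Field c ℓ) (L : ℕ) .{{_ : NonZero L}} where
  open FieldDefs.WithL K L using (expo)
  open CommutativeSemigroupProperties ℕₚ.+-commutativeSemigroup using (xy∙z≈xz∙y)

  private
    gap : Fin L → ℕ
    gap i = L ℕ.∸ suc (toℕ i)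

    toℕ+gap : ∀ i → suc (toℕ i) ℕ.+ gap i ≡ L
    toℕ+gap i = ℕₚ.m+[n∸m]≡n (Finₚ.toℕ<n i)

    gap<L : ∀ i → gap i ℕ.< L
    gap<L i = ≡.subst (gap i ℕ.<_) (toℕ+gap i) (ℕₚ.m<n+m (gap i) ℕ.z<s)

    expo≡ : ∀ k i → expo k i ≡ (k ℕ.+ gap i) / L
    expo≡ k i = ≡.cong (_/ L) (ℕₚ.+-∸-assoc k (Finₚ.toℕ<n i))

  expo-+* : ∀ k q i → expo (k ℕ.+ q ℕ.* L) i ≡ expo k i ℕ.+ q
  expo-+* k q i = begin
    expo (k ℕ.+ q ℕ.* L) i               ≡⟨ expo≡ (k ℕ.+ q ℕ.* L) i ⟩
    (k ℕ.+ q ℕ.* L ℕ.+ gap i) / L        ≡⟨ ≡.cong (_/ L) (xy∙z≈xz∙y k (q ℕ.* L) (gap i)) ⟩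
    (k ℕ.+ gap i ℕ.+ q ℕ.* L) / L        ≡⟨ +-distrib-/-∣ʳ (k ℕ.+ gap i) (divides q ≡.refl) ⟩
    (k ℕ.+ gap i) / L ℕ.+ q ℕ.* L / L    ≡⟨ ≡.cong₂ ℕ._+_ (≡.sym (expo≡ k i)) (m*n/n≡m q L) ⟩
    expo k i ℕ.+ q                       ∎
    where open ≡.≡-Reasoning

  expo≡0 : ∀ ρ i → ρ ℕ.≤ toℕ i → expo ρ i ≡ 0
  expo≡0 ρ i ρ≤i = ≡.trans (expo≡ ρ i) (m<n⇒m/n≡0 (≡.subst (ρ ℕ.+ gap i ℕ.<_) (toℕ+gap i) (ℕ.s≤s (ℕₚ.+-monoˡ-≤ (gap i) ρ≤i))))

  expo≡1 : ∀ ρ i → ρ ℕ.≤ L → toℕ i ℕ.< ρ → expo ρ i ≡ 1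
  expo≡1 ρ i ρ≤L i<ρ = ≡.trans (expo≡ ρ i) (≡.trans (m/n≡1+[m∸n]/n L≤ρ+gap) (≡.cong suc (m<n⇒m/n≡0 ρ+gap∸L<L)))
    where
    L≤ρ+gap : L ℕ.≤ ρ ℕ.+ gap i
    L≤ρ+gap = ≡.subst (ℕ._≤ ρ ℕ.+ gap i) (toℕ+gap i) (ℕₚ.+-monoˡ-≤ (gap i) i<ρ)
    ρ+gap∸L<L : ρ ℕ.+ gap i ℕ.∸ L ℕ.< L
    ρ+gap∸L<L = ℕₚ.m<n+o⇒m∸n<o (ρ ℕ.+ gap i) L (ℕₚ.+-mono-≤-< ρ≤L (gap<L i))

  expo-zero : ∀ i → expo 0 i ≡ 0
  expo-zero i = expo≡0 0 i ℕ.z≤n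

  residue : ℕ → Fin L
  residue k = Fin.fromℕ< (m%n<n k L)

  private
    -- k = ρ + q L with ρ = k % L, and then expo k i = [toℕ i < ρ] + q.
    expo-split : ∀ k i → expo k i ≡ expo (k % L) i ℕ.+ k / L
    expo-split k i = ≡.trans (≡.cong (λ m → expo m i) (m≡m%n+[m/n]*n k L)) (expo-+* (k % L) (k / L) i)

    expo-suc-split : ∀ k i → expo (suc k) i ≡ expo (suc (k % L)) i ℕ.+ k / L
    expo-suc-split k i = ≡.trans (≡.cong (λ m → expo (suc m) i) (m≡m%n+[m/n]*n k L)) (expo-+* (suc (k % L)) (k / L) i)

  expo-suc-residue : ∀ k → expo (suc k) (residue k) ≡ suc (expo k (residue k))
  expo-suc-residue k = begin
    expo (suc k) r               ≡⟨ expo-suc-split k r ⟩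
    expo (suc ρ) r ℕ.+ k / L     ≡⟨ ≡.cong (ℕ._+ k / L) (expo≡1 (suc ρ) r (m%n<n k L) (ℕ.s≤s (ℕₚ.≤-reflexive r≡ρ))) ⟩
    suc (k / L)                  ≡⟨ ≡.cong (λ e → suc (e ℕ.+ k / L)) (expo≡0 ρ r (ℕₚ.≤-reflexive (≡.sym r≡ρ))) ⟨
    suc (expo ρ r ℕ.+ k / L)     ≡⟨ ≡.cong suc (expo-split k r) ⟨
    suc (expo k r)               ∎
    where
    open ≡.≡-Reasoning
    ρ = k % L
    r = residue k
    r≡ρ : toℕ r ≡ ρ
    r≡ρ = Finₚ.toℕ-fromℕ< (m%n<n k L)

  expo-suc-other : ∀ k i → i ≢ residue k → expo (suc k) i ≡ expo k i
  expo-suc-other k i i≢r = ≡.trans (expo-suc-split k i) (≡.trans (≡.cong (ℕ._+ k / L) small) (≡.sym (expo-split k i)))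
    where
    ρ = k % L
    small : expo (suc ρ) i ≡ expo ρ i
    small with ℕₚ.<-cmp (toℕ i) ρ
    ... | tri< i<ρ _ _ = ≡.trans (expo≡1 (suc ρ) i (m%n<n k L) (ℕₚ.m<n⇒m<1+n i<ρ)) (≡.sym (expo≡1 ρ i (ℕₚ.<⇒≤ (m%n<n k L)) i<ρ))
    ... | tri≈ _ i≡ρ _ = ⊥-elim (i≢r (Finₚ.toℕ-injective (≡.trans i≡ρ (≡.sym (Finₚ.toℕ-fromℕ< (m%n<n k L))))))
    ... | tri> _ _ ρ<i = ≡.trans (expo≡0 (suc ρ) i ρ<i) (≡.sym (expo≡0 ρ i (ℕₚ.<⇒≤ ρ<i)))

module RiordanColumns {c ℓ} (K : Field c ℓ) (L : ℕ) .{{_ : NonZero L}} where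
  open Field K hiding (zero)
  open FieldDefs K
  open WithL L
  open SeriesRing K
  open Series K
  open ColumnExponents K L

  prodFin-cong : ∀ {m} {s s′ : Fin m → Series} → (∀ i → s i ≈ₛ s′ i) → prodFin s ≈ₛ prodFin s′
  prodFin-cong {zero}  s≈s′ = ≈ₛ-refl
  prodFin-cong {suc m} s≈s′ = ⋆-cong (s≈s′ Fin.zero) (prodFin-cong (λ i → s≈s′ (Fin.suc i)))

  prodFin-oneₛ : ∀ {m} (s : Fin m → Series) → (∀ i → s i ≈ₛ oneₛ) → prodFin s ≈ₛ oneₛ
  prodFin-oneₛ {zero}  s s≈1 = ≈ₛ-refl
  prodFin-oneₛ {suc m} s s≈1 = ≈ₛ-trans (⋆-cong (s≈1 Fin.zero) (prodFin-oneₛ _ (λ i → s≈1 (Fin.suc i)))) (⋆-identityˡ oneₛ)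

  prodFin-⋆ : ∀ {m} (a b : Fin m → Series) → prodFin (λ i → a i ⋆ b i) ≈ₛ (prodFin a ⋆ prodFin b)
  prodFin-⋆ {zero}  a b = ≈ₛ-sym (⋆-identityˡ oneₛ)
  prodFin-⋆ {suc m} a b = ≈ₛ-trans (⋆-congˡ (a Fin.zero ⋆ b Fin.zero) (prodFin-⋆ (λ i → a (Fin.suc i)) (λ i → b (Fin.suc i))))
                                   (interchange (a Fin.zero) (b Fin.zero) (prodFin (λ i → a (Fin.suc i))) (prodFin (λ i → b (Fin.suc i))))

  prodFin-const : ∀ m a → prodFin {m} (λ _ → a) ≈ₛ (a ^ₛ m)
  prodFin-const zero    a = ≈ₛ-refl
  prodFin-const (suc m) a = ⋆-cong ≈ₛ-refl (prodFin-const m a)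

  prodFin-⋆-const : ∀ {m} (s : Fin m → Series) a → prodFin (λ i → s i ⋆ a) ≈ₛ (prodFin s ⋆ (a ^ₛ m))
  prodFin-⋆-const {m} s a = ≈ₛ-trans (prodFin-⋆ s (λ _ → a)) (⋆-congˡ (prodFin s) (prodFin-const m a))

  prodFin-t⋆ : ∀ {m} (w : Fin m → Series) → prodFin (λ i → tₛ ⋆ w i) ≈ₛ ((tₛ ^ₛ m) ⋆ prodFin w)
  prodFin-t⋆ {m} w = ≈ₛ-trans (prodFin-⋆ (λ _ → tₛ) w) (⋆-congʳ (prodFin w) (prodFin-const m tₛ))

  prodFin-^ₛ : ∀ {m} (s : Fin m → Series) q → prodFin (λ i → s i ^ₛ q) ≈ₛ (prodFin s ^ₛ q)
  prodFin-^ₛ s zero    = prodFin-oneₛ (λ i → s i ^ₛ zero) (λ _ → ≈ₛ-refl)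
  prodFin-^ₛ s (suc q) = ≈ₛ-trans (prodFin-⋆ s (λ i → s i ^ₛ q)) (⋆-congˡ (prodFin s) (prodFin-^ₛ s q))

  prodFin-update : ∀ {m} (s s′ : Fin m → Series) r x → s′ r ≈ₛ (s r ⋆ x) → (∀ i → i ≢ r → s′ i ≈ₛ s i) →
                   prodFin s′ ≈ₛ (prodFin s ⋆ x)
  prodFin-update {suc m} s s′ Fin.zero x s′r≈ others =
    ≈ₛ-trans (⋆-cong s′r≈ (prodFin-cong (λ i → others (Fin.suc i) (λ ())))) (xy∙z≈xz∙y (s Fin.zero) x (prodFin (λ i → s (Fin.suc i))))
  prodFin-update {suc m} s s′ (Fin.suc r) x s′r≈ others =
    ≈ₛ-trans (⋆-cong (others Fin.zero (λ ()))
                     (prodFin-update (λ i → s (Fin.suc i)) (λ i → s′ (Fin.suc i)) r x s′r≈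
                                     (λ i i≢r → others (Fin.suc i) (λ i≡r → i≢r (Finₚ.suc-injective i≡r)))))
             (≈ₛ-sym (⋆-assoc (s Fin.zero) (prodFin (λ i → s (Fin.suc i))) x))

  riordanCol-cong : ∀ {g g′ Fs Fs′} → g ≈ₛ g′ → (∀ i → Fs i ≈ₛ Fs′ i) → ∀ k → riordanCol g Fs k ≈ₛ riordanCol g′ Fs′ k
  riordanCol-cong g≈g′ Fs≈Fs′ k = ⋆-cong g≈g′ (prodFin-cong (λ i → ^ₛ-cong (expo k i) (Fs≈Fs′ i)))

  riordan-cong : ∀ {g g′ Fs Fs′} → g ≈ₛ g′ → (∀ i → Fs i ≈ₛ Fs′ i) → riordan g Fs ≈ₘ riordan g′ Fs′
  riordan-cong g≈g′ Fs≈Fs′ n k = riordanCol-cong g≈g′ Fs≈Fs′ k n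

  module Columns (g : Series) (Fs : Fin L → Series) where

    col : ℕ → Series
    col = riordanCol g Fs

    col-zero : col 0 ≈ₛ g
    col-zero = ≈ₛ-trans (⋆-congˡ g (prodFin-oneₛ _ (λ i → ^ₛ-congʳ (Fs i) (expo-zero i))))
                        (⋆-identityʳ g)

    col-suc : ∀ k → col (suc k) ≈ₛ (col k ⋆ Fs (residue k))
    col-suc k = ≈ₛ-trans (⋆-congˡ g (prodFin-update (λ i → Fs i ^ₛ expo k i) (λ i → Fs i ^ₛ expo (suc k) i) r (Fs r) at-r off-r))
                         (≈ₛ-sym (⋆-assoc g (prodFin (λ i → Fs i ^ₛ expo k i)) (Fs r)))
      where
      r = residue k
      at-r : (Fs r ^ₛ expo (suc k) r) ≈ₛ ((Fs r ^ₛ expo k r) ⋆ Fs r)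
      at-r rewrite expo-suc-residue k = ⋆-comm (Fs r) (Fs r ^ₛ expo k r)
      off-r : ∀ i → i ≢ r → (Fs i ^ₛ expo (suc k) i) ≈ₛ (Fs i ^ₛ expo k i)
      off-r i i≢r rewrite expo-suc-other k i i≢r = ≈ₛ-refl

    col-+* : ∀ k q → col (k ℕ.+ q ℕ.* L) ≈ₛ (col k ⋆ (prodF Fs ^ₛ q))
    col-+* k q = begin
      g ⋆ prodFin (λ i → Fs i ^ₛ expo (k ℕ.+ q ℕ.* L) i)          ≈⟨ ⋆-congˡ g (prodFin-cong (λ i → ^ₛ-congʳ (Fs i) (expo-+* k q i))) ⟩
      g ⋆ prodFin (λ i → Fs i ^ₛ (expo k i ℕ.+ q))                 ≈⟨ ⋆-congˡ g (prodFin-cong (λ i → ≈ₛ-sym (^ₛ-+ (Fs i) (expo k i) q))) ⟩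
      g ⋆ prodFin (λ i → (Fs i ^ₛ expo k i) ⋆ (Fs i ^ₛ q))         ≈⟨ ⋆-congˡ g (prodFin-⋆ (λ i → Fs i ^ₛ expo k i) (λ i → Fs i ^ₛ q)) ⟩
      g ⋆ (prodFin (λ i → Fs i ^ₛ expo k i) ⋆ prodFin (λ i → Fs i ^ₛ q))
                                                                   ≈⟨ ⋆-assoc g (prodFin (λ i → Fs i ^ₛ expo k i)) (prodFin (λ i → Fs i ^ₛ q)) ⟨
      col k ⋆ prodFin (λ i → Fs i ^ₛ q)                            ≈⟨ ⋆-congˡ (col k) (prodFin-^ₛ Fs q) ⟩
      col k ⋆ (prodF Fs ^ₛ q)                                      ∎
      where open ≈ₛ-Reasoning

module RiordanArrays {c ℓ} (K : Field c ℓ) (L : ℕ) .{{_ : NonZero L}} where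
  open Field K hiding (zero)
  open FieldDefs K
  open WithL L
  open FieldProperties K
  open SeriesRing K
  open Series K
  open SeriesInKtl K L
  open InfiniteMatrices K L
  open ColumnExponents K L
  open RiordanColumns K L public

  ValidG-resp : ∀ {g g′} → g ≈ₛ g′ → ValidG g → ValidG g′
  ValidG-resp g≈g′ (g∈ , g0≉0) = InKtl-resp g≈g′ g∈ , ≉0-resp-≈ (g≈g′ 0) g0≉0

  module Valid (g : Series) (Fs : Fin L → Series) (g-valid : ValidG g) (Fs-valid : ValidFs Fs) where
    open Columns g Fs public

    R : Matrix
    R = riordan g Fs

    g-InKtl : InKtl g
    g-InKtl = proj₁ g-valid

    g0≉0 : g 0 ≉ 0#
    g0≉0 = proj₂ g-valid

    w : Fin L → Series
    w i = proj₁ (proj₁ (Fs-valid i))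

    w-InKtl : ∀ i → InKtl (w i)
    w-InKtl i = proj₁ (proj₂ (proj₁ (Fs-valid i)))

    Fs≈t⋆w : ∀ i → Fs i ≈ₛ (tₛ ⋆ w i)
    Fs≈t⋆w i = proj₂ (proj₂ (proj₁ (Fs-valid i)))

    w0≉0 : ∀ i → w i 0 ≉ 0#
    w0≉0 i = ≉0-resp-≈ (trans (Fs≈t⋆w i 1) (t⋆≈shift (w i) 1)) (proj₂ (Fs-valid i))

    col-suc-shift : ∀ k → col (suc k) ≈ₛ shift (col k ⋆ w (residue k))
    col-suc-shift k = begin
      col (suc k)                       ≈⟨ col-suc k ⟩
      col k ⋆ Fs r                      ≈⟨ ⋆-congˡ (col k) (Fs≈t⋆w r) ⟩
      col k ⋆ (tₛ ⋆ w r)                ≈⟨ x∙yz≈y∙xz (col k) tₛ (w r) ⟩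
      tₛ ⋆ (col k ⋆ w r)                ≈⟨ t⋆≈shift _ ⟩
      shift (col k ⋆ w r)               ∎
      where
      open ≈ₛ-Reasoning
      r = residue k

    col-order : ∀ k → Order≥ k (col k)
    col-order zero    n ()
    col-order (suc k) = Order≥-resp (suc k) (≈ₛ-sym (col-suc-shift k))
      (Order≥-shift k _ (Order≥-⋆ k (col k) (w (residue k)) (col-order k)))

    col-diagonal : ∀ k → col k k ≉ 0#
    col-diagonal zero    = ≉0-resp-≈ (sym (col-zero 0)) g0≉0
    col-diagonal (suc k) = ≉0-resp-≈ (sym (trans (col-suc-shift k (suc k)) (⋆-at-order k (col k) (w (residue k)) (col-order k))))
                                    (*-≉0 (col-diagonal k) (w0≉0 (residue k)))

    col-homogeneous : ∀ k → Homogeneous k (col k)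
    col-homogeneous zero    = Homogeneous-resp 0 (≈ₛ-sym col-zero) (InKtl⇒Homogeneous g-InKtl)
    col-homogeneous (suc k) = Homogeneous-resp (suc k) (≈ₛ-sym (col-suc-shift k)) (Homogeneous-shift k _
      (≡.subst (λ r → Homogeneous r (col k ⋆ w (residue k))) (ℕₚ.+-identityʳ k)
        (Homogeneous-⋆ k 0 (col k) (w (residue k)) (col-homogeneous k) (InKtl⇒Homogeneous (w-InKtl (residue k))))))

    R-lowerTriangular : LowerTriangular R
    R-lowerTriangular n k n<k = col-order k n n<k

    R-nonzeroDiagonal : NonzeroDiagonal R
    R-nonzeroDiagonal = col-diagonal

    R-gradePreserving : GradePreserving R
    R-gradePreserving n k L∣k = Homogeneous⇒InKtl L∣k (col-homogeneous k) n

    R▷δ : ∀ k → (R ▷ δ k) ≈ₛ col k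
    R▷δ k = ▷δ R k R-lowerTriangular

    R▷-InKtl : ∀ {v} → InKtl v → InKtl (R ▷ v)
    R▷-InKtl = ▷-InKtl R R-gradePreserving

    R▷-constant : ∀ v → (R ▷ v) 0 ≈ g 0 * v 0
    R▷-constant v = trans (+-identityˡ _) (*-congʳ (col-zero 0))

    R▷-oneₛ : (R ▷ oneₛ) ≈ₛ g
    R▷-oneₛ = ≈ₛ-trans (▷-congʳ R oneₛ≈δ0) (≈ₛ-trans (R▷δ 0) col-zero)

    open Inverse g g0≉0 public using () renaming
      (b⁻¹ to g⁻¹; b⁻¹-inverseʳ to g⁻¹-inverseʳ; b⁻¹-constant-≉0 to g⁻¹-constant-≉0; b⋆-cancel to g⋆-cancel)

    g⁻¹-InKtl : InKtl g⁻¹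
    g⁻¹-InKtl = InKtl-inverse g0≉0 g-InKtl

    col-+-multiple : ∀ j m → L ∣ m → (col (m ℕ.+ j) ⋆ g) ≈ₛ (col m ⋆ col j)
    col-+-multiple j m (divides q ≡.refl) = begin
      col (q ℕ.* L ℕ.+ j) ⋆ g        ≡⟨ ≡.cong (λ k → col k ⋆ g) (ℕₚ.+-comm (q ℕ.* L) j) ⟩
      col (j ℕ.+ q ℕ.* L) ⋆ g        ≈⟨ ⋆-congʳ g (col-+* j q) ⟩
      (col j ⋆ (P ^ₛ q)) ⋆ g         ≈⟨ xy∙z≈zy∙x (col j) (P ^ₛ q) g ⟩
      (g ⋆ (P ^ₛ q)) ⋆ col j         ≈⟨ ⋆-congʳ (col j) (≈ₛ-trans (col-+* 0 q) (⋆-congʳ (P ^ₛ q) col-zero)) ⟨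
      col (q ℕ.* L) ⋆ col j          ∎
      where
      open ≈ₛ-Reasoning
      P = prodF Fs

    R▷-⋆-δ : ∀ j {c} → InKtl c → (g ⋆ (R ▷ (δ j ⋆ c))) ≈ₛ ((R ▷ c) ⋆ col j)
    R▷-⋆-δ j {c} c∈ = begin
      g ⋆ (R ▷ (δ j ⋆ c))                                  ≈⟨ ⋆-comm g _ ⟩
      (R ▷ (δ j ⋆ c)) ⋆ g                                  ≈⟨ ⋆-congʳ g (▷-congʳ R (⋆-comm (δ j) c)) ⟩
      (R ▷ (c ⋆ δ j)) ⋆ g                                  ≈⟨ ⋆-congʳ g (▷-⋆ R c (δ j)) ⟩
      ((R ·ₘ multiplication (δ j)) ▷ c) ⋆ g                ≈⟨ ⋆-▷ (R ·ₘ multiplication (δ j)) c g RMδ-lower ⟩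
      (multiplication g ·ₘ (R ·ₘ multiplication (δ j))) ▷ c ≈⟨ ▷-cong-InKtl _ _ same-columns c∈ ⟩
      (multiplication (col j) ·ₘ R) ▷ c                     ≈⟨ ⋆-▷ R c (col j) R-lowerTriangular ⟨
      (R ▷ c) ⋆ col j                                      ∎
      where
      open ≈ₛ-Reasoning
      RMδ-lower = ·ₘ-lowerTriangular R (multiplication (δ j)) (multiplication-lowerTriangular (δ j))
      same-columns : ∀ n m → L ∣ m → (multiplication g ·ₘ (R ·ₘ multiplication (δ j))) n m ≈ (multiplication (col j) ·ₘ R) n m
      same-columns n m L∣m = (begin
        multiplication g ▷ (R ▷ column (multiplication (δ j)) m) ≈⟨ multiplication-▷ g _ ⟩
        (R ▷ column (multiplication (δ j)) m) ⋆ g                ≈⟨ ⋆-congʳ g (▷-congʳ R (≈ₛ-trans (multiplication-column (δ j) m) (δ⋆δ m j))) ⟩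
        (R ▷ δ (m ℕ.+ j)) ⋆ g                                    ≈⟨ ⋆-congʳ g (R▷δ (m ℕ.+ j)) ⟩
        col (m ℕ.+ j) ⋆ g                                        ≈⟨ col-+-multiple j m L∣m ⟩
        col m ⋆ col j                                            ≈⟨ multiplication-▷ (col j) (col m) ⟨
        multiplication (col j) ▷ col m                           ∎) n

    R▷-⋆ : ∀ a {c} → InKtl c → (g ⋆ (R ▷ (a ⋆ c))) ≈ₛ ((R ▷ a) ⋆ (R ▷ c))
    R▷-⋆ a {c} c∈ = begin
      g ⋆ (R ▷ (a ⋆ c))                                ≈⟨ ⋆-comm g _ ⟩
      (R ▷ (a ⋆ c)) ⋆ g                                ≈⟨ ⋆-congʳ g (▷-⋆ R a c) ⟩
      ((R ·ₘ multiplication c) ▷ a) ⋆ g                ≈⟨ ⋆-▷ (R ·ₘ multiplication c) a g RMc-lower ⟩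
      (multiplication g ·ₘ (R ·ₘ multiplication c)) ▷ a ≈⟨ ▷-congˡ a same-columns ⟩
      (multiplication (R ▷ c) ·ₘ R) ▷ a                 ≈⟨ ⋆-▷ R a (R ▷ c) R-lowerTriangular ⟨
      (R ▷ a) ⋆ (R ▷ c)                                ∎
      where
      open ≈ₛ-Reasoning
      RMc-lower = ·ₘ-lowerTriangular R (multiplication c) (multiplication-lowerTriangular c)
      same-columns : (multiplication g ·ₘ (R ·ₘ multiplication c)) ≈ₘ (multiplication (R ▷ c) ·ₘ R)
      same-columns n j = (begin
        multiplication g ▷ (R ▷ column (multiplication c) j) ≈⟨ multiplication-▷ g _ ⟩
        (R ▷ column (multiplication c) j) ⋆ g                ≈⟨ ⋆-comm _ g ⟩
        g ⋆ (R ▷ column (multiplication c) j)                ≈⟨ ⋆-congˡ g (▷-congʳ R (multiplication-column c j)) ⟩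
        g ⋆ (R ▷ (δ j ⋆ c))                                  ≈⟨ R▷-⋆-δ j c∈ ⟩
        (R ▷ c) ⋆ col j                                      ≈⟨ ⋆-comm (R ▷ c) (col j) ⟩
        col j ⋆ (R ▷ c)                                      ≈⟨ multiplication-▷ (R ▷ c) (col j) ⟨
        multiplication (R ▷ c) ▷ col j                       ∎) n

    R▷-prodFin : ∀ m (s : Fin m → Series) → (∀ i → InKtl (s i)) → ((g ^ₛ m) ⋆ (R ▷ prodFin s)) ≈ₛ (g ⋆ prodFin (λ i → R ▷ s i))
    R▷-prodFin zero    s s∈ = ≈ₛ-trans (⋆-identityˡ _) (≈ₛ-trans R▷-oneₛ (≈ₛ-sym (⋆-identityʳ g)))
    R▷-prodFin (suc m) s s∈ = begin
      (g ⋆ (g ^ₛ m)) ⋆ (R ▷ (s₀ ⋆ Π))          ≈⟨ xy∙z≈xz∙y g (g ^ₛ m) (R ▷ (s₀ ⋆ Π)) ⟩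
      (g ⋆ (R ▷ (s₀ ⋆ Π))) ⋆ (g ^ₛ m)          ≈⟨ ⋆-congʳ (g ^ₛ m) (R▷-⋆ s₀ (InKtl-prodFin _ (λ i → s∈ (Fin.suc i)))) ⟩
      ((R ▷ s₀) ⋆ (R ▷ Π)) ⋆ (g ^ₛ m)          ≈⟨ xy∙z≈xz∙y (R ▷ s₀) (R ▷ Π) (g ^ₛ m) ⟩
      ((R ▷ s₀) ⋆ (g ^ₛ m)) ⋆ (R ▷ Π)          ≈⟨ ⋆-assoc (R ▷ s₀) (g ^ₛ m) (R ▷ Π) ⟩
      (R ▷ s₀) ⋆ ((g ^ₛ m) ⋆ (R ▷ Π))          ≈⟨ ⋆-congˡ (R ▷ s₀) (R▷-prodFin m (λ i → s (Fin.suc i)) (λ i → s∈ (Fin.suc i))) ⟩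
      (R ▷ s₀) ⋆ (g ⋆ RΠ)                      ≈⟨ x∙yz≈y∙xz (R ▷ s₀) g RΠ ⟩
      g ⋆ ((R ▷ s₀) ⋆ RΠ)                      ∎
      where
      open ≈ₛ-Reasoning
      s₀ = s Fin.zero
      Π  = prodFin (λ i → s (Fin.suc i))
      RΠ = prodFin (λ i → R ▷ s (Fin.suc i))

  module Product (g : Series) (Fs : Fin L → Series) (g-valid : ValidG g) (Fs-valid : ValidFs Fs)
                 (d : Series) (Hs : Fin L → Series) (d-valid : ValidG d) (Hs-valid : ValidFs Hs) where
    module A = Valid g Fs g-valid Fs-valid
    module B = Valid d Hs d-valid Hs-valid

    g″ : Series
    g″ = A.R ▷ d

    F″ : Fin L → Series
    F″ i = (Fs i ⋆ (A.R ▷ B.w i)) ⋆ A.g⁻¹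

    B-col÷tᵏ : ℕ → Series
    B-col÷tᵏ zero    = d
    B-col÷tᵏ (suc k) = B-col÷tᵏ k ⋆ B.w (residue k)

    B-col÷tᵏ-InKtl : ∀ k → InKtl (B-col÷tᵏ k)
    B-col÷tᵏ-InKtl zero    = B.g-InKtl
    B-col÷tᵏ-InKtl (suc k) = InKtl-⋆ (B-col÷tᵏ-InKtl k) (B.w-InKtl (residue k))

    B-col≈δ⋆ : ∀ k → B.col k ≈ₛ (δ k ⋆ B-col÷tᵏ k)
    B-col≈δ⋆ zero    = ≈ₛ-trans B.col-zero (≈ₛ-trans (≈ₛ-sym (⋆-identityˡ d)) (⋆-congʳ d oneₛ≈δ0))
    B-col≈δ⋆ (suc k) = begin
      B.col (suc k)                          ≈⟨ B.col-suc k ⟩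
      B.col k ⋆ Hs r                         ≈⟨ ⋆-cong (B-col≈δ⋆ k) (B.Fs≈t⋆w r) ⟩
      (δ k ⋆ B-col÷tᵏ k) ⋆ (tₛ ⋆ B.w r)      ≈⟨ interchange (δ k) (B-col÷tᵏ k) tₛ (B.w r) ⟩
      (δ k ⋆ tₛ) ⋆ (B-col÷tᵏ k ⋆ B.w r)      ≈⟨ ⋆-congʳ (B-col÷tᵏ k ⋆ B.w r) δk⋆t ⟩
      δ (suc k) ⋆ B-col÷tᵏ (suc k)           ∎
      where
      open ≈ₛ-Reasoning
      r = residue k
      δk⋆t : (δ k ⋆ tₛ) ≈ₛ δ (suc k)
      δk⋆t = ≈ₛ-trans (⋆-comm (δ k) tₛ) (≈ₛ-trans (t⋆≈shift (δ k)) (shift-δ k))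

    C : ℕ → Series
    C k = A.R ▷ B.col k

    g⋆C : ∀ k → (g ⋆ C k) ≈ₛ (A.col k ⋆ (A.R ▷ B-col÷tᵏ k))
    g⋆C k = begin
      g ⋆ (A.R ▷ B.col k)                    ≈⟨ ⋆-congˡ g (▷-congʳ A.R (B-col≈δ⋆ k)) ⟩
      g ⋆ (A.R ▷ (δ k ⋆ B-col÷tᵏ k))         ≈⟨ A.R▷-⋆ (δ k) (B-col÷tᵏ-InKtl k) ⟩
      (A.R ▷ δ k) ⋆ (A.R ▷ B-col÷tᵏ k)       ≈⟨ ⋆-congʳ (A.R ▷ B-col÷tᵏ k) (A.R▷δ k) ⟩
      A.col k ⋆ (A.R ▷ B-col÷tᵏ k)           ∎
      where open ≈ₛ-Reasoning

    C-suc : ∀ k → C (suc k) ≈ₛ (C k ⋆ F″ (residue k))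
    C-suc k = A.g⋆-cancel (A.g⋆-cancel g²⋆C-suc)
      where
      open ≈ₛ-Reasoning
      r  = residue k
      Rc = A.R ▷ B-col÷tᵏ k
      Rw = A.R ▷ B.w r
      g⋆F″ : (g ⋆ F″ r) ≈ₛ (Fs r ⋆ Rw)
      g⋆F″ = begin
        g ⋆ ((Fs r ⋆ Rw) ⋆ A.g⁻¹)     ≈⟨ x∙yz≈y∙xz g (Fs r ⋆ Rw) A.g⁻¹ ⟩
        (Fs r ⋆ Rw) ⋆ (g ⋆ A.g⁻¹)     ≈⟨ ⋆-congˡ (Fs r ⋆ Rw) A.g⁻¹-inverseʳ ⟩
        (Fs r ⋆ Rw) ⋆ oneₛ            ≈⟨ ⋆-identityʳ (Fs r ⋆ Rw) ⟩
        Fs r ⋆ Rw                     ∎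
      g²⋆C-suc : (g ⋆ (g ⋆ C (suc k))) ≈ₛ (g ⋆ (g ⋆ (C k ⋆ F″ r)))
      g²⋆C-suc = begin
        g ⋆ (g ⋆ C (suc k))                                ≈⟨ ⋆-congˡ g (g⋆C (suc k)) ⟩
        g ⋆ (A.col (suc k) ⋆ (A.R ▷ (B-col÷tᵏ k ⋆ B.w r))) ≈⟨ x∙yz≈y∙xz g (A.col (suc k)) (A.R ▷ (B-col÷tᵏ k ⋆ B.w r)) ⟩
        A.col (suc k) ⋆ (g ⋆ (A.R ▷ (B-col÷tᵏ k ⋆ B.w r))) ≈⟨ ⋆-cong (A.col-suc k) (A.R▷-⋆ (B-col÷tᵏ k) (B.w-InKtl r)) ⟩
        (A.col k ⋆ Fs r) ⋆ (Rc ⋆ Rw)                       ≈⟨ interchange (A.col k) (Fs r) Rc Rw ⟩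
        (A.col k ⋆ Rc) ⋆ (Fs r ⋆ Rw)                       ≈⟨ ⋆-cong (g⋆C k) g⋆F″ ⟨
        (g ⋆ C k) ⋆ (g ⋆ F″ r)                             ≈⟨ interchange g g (C k) (F″ r) ⟨
        (g ⋆ g) ⋆ (C k ⋆ F″ r)                             ≈⟨ ⋆-assoc g g (C k ⋆ F″ r) ⟩
        g ⋆ (g ⋆ (C k ⋆ F″ r))                             ∎

    C≈col : ∀ k → C k ≈ₛ riordanCol g″ F″ k
    C≈col zero    = ≈ₛ-trans (▷-congʳ A.R B.col-zero) (≈ₛ-sym (Columns.col-zero g″ F″))
    C≈col (suc k) = ≈ₛ-trans (C-suc k) (≈ₛ-trans (⋆-congʳ (F″ (residue k)) (C≈col k)) (≈ₛ-sym (Columns.col-suc g″ F″ k)))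

    product : (A.R ·ₘ B.R) ≈ₘ riordan g″ F″
    product n k = C≈col k n

    g″-valid : ValidG g″
    g″-valid = A.R▷-InKtl B.g-InKtl , ≉0-resp-≈ (sym (A.R▷-constant d)) (*-≉0 A.g0≉0 B.g0≉0)

    w″ : Fin L → Series
    w″ i = (A.w i ⋆ (A.R ▷ B.w i)) ⋆ A.g⁻¹

    F″≈t⋆w″ : ∀ i → F″ i ≈ₛ (tₛ ⋆ w″ i)
    F″≈t⋆w″ i = begin
      (Fs i ⋆ Rw) ⋆ A.g⁻¹            ≈⟨ ⋆-congʳ A.g⁻¹ (⋆-congʳ Rw (A.Fs≈t⋆w i)) ⟩
      ((tₛ ⋆ A.w i) ⋆ Rw) ⋆ A.g⁻¹    ≈⟨ ⋆-congʳ A.g⁻¹ (⋆-assoc tₛ (A.w i) Rw) ⟩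
      (tₛ ⋆ (A.w i ⋆ Rw)) ⋆ A.g⁻¹    ≈⟨ ⋆-assoc tₛ (A.w i ⋆ Rw) A.g⁻¹ ⟩
      tₛ ⋆ w″ i                      ∎
      where
      open ≈ₛ-Reasoning
      Rw = A.R ▷ B.w i

    F″-valid : ValidFs F″
    F″-valid i = (w″ i , w″-InKtl , F″≈t⋆w″ i) , ≉0-resp-≈ (sym (trans (F″≈t⋆w″ i 1) (t⋆≈shift (w″ i) 1))) w″0≉0
      where
      Rw = A.R ▷ B.w i
      w″-InKtl : InKtl (w″ i)
      w″-InKtl = InKtl-⋆ (InKtl-⋆ (A.w-InKtl i) (A.R▷-InKtl (B.w-InKtl i))) A.g⁻¹-InKtl
      Rw0≉0 : Rw 0 ≉ 0#
      Rw0≉0 = ≉0-resp-≈ (sym (A.R▷-constant (B.w i))) (*-≉0 A.g0≉0 (B.w0≉0 i))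
      w″0≉0 : w″ i 0 ≉ 0#
      w″0≉0 = ⋆-constant-≉0 (A.w i ⋆ Rw) A.g⁻¹ (⋆-constant-≉0 (A.w i) Rw (A.w0≉0 i) Rw0≉0) A.g⁻¹-constant-≉0

  oneₛ-valid : ValidG oneₛ
  oneₛ-valid = InKtl-oneₛ , 1≉0

  tₛ-valid : ValidFs (λ _ → tₛ)
  tₛ-valid _ = (oneₛ , InKtl-oneₛ , ≈ₛ-sym (⋆-identityʳ tₛ)) , 1≉0

  identity-col : ∀ k → riordanCol oneₛ (λ _ → tₛ) k ≈ₛ δ k
  identity-col zero    = ≈ₛ-trans (Columns.col-zero oneₛ (λ _ → tₛ)) oneₛ≈δ0
  identity-col (suc k) = ≈ₛ-trans (Columns.col-suc oneₛ (λ _ → tₛ) k)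
    (≈ₛ-trans (⋆-congʳ tₛ (identity-col k)) (≈ₛ-trans (⋆-comm (δ k) tₛ) (≈ₛ-trans (t⋆≈shift (δ k)) (shift-δ k))))

  Iₘ≈riordan : Iₘ ≈ₘ riordan oneₛ (λ _ → tₛ)
  Iₘ≈riordan n k = trans (Iₘ≈δ n k) (sym (identity-col k n))

  riordan-lowerTriangular : ∀ {g Fs} → ValidG g → ValidFs Fs → LowerTriangular (riordan g Fs)
  riordan-lowerTriangular g-valid Fs-valid = Valid.R-lowerTriangular _ _ g-valid Fs-valid

  -- The inverse is (d; t v₁, …, t v_L) with R d = 1 and R vᵢ = g / wᵢ, so that the product formula gives (1; t, …, t).
  module RiordanInverse (g : Series) (Fs : Fin L → Series) (g-valid : ValidG g) (Fs-valid : ValidFs Fs) where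
    module A = Valid g Fs g-valid Fs-valid

    d : Series
    d = TriangularSystem.solution A.R A.R-nonzeroDiagonal oneₛ

    R▷d : (A.R ▷ d) ≈ₛ oneₛ
    R▷d = TriangularSystem.solves A.R A.R-nonzeroDiagonal oneₛ

    w⁻¹ : Fin L → Series
    w⁻¹ i = Inverse.b⁻¹ (A.w i) (A.w0≉0 i)

    v : Fin L → Series
    v i = TriangularSystem.solution A.R A.R-nonzeroDiagonal (g ⋆ w⁻¹ i)

    R▷v : ∀ i → (A.R ▷ v i) ≈ₛ (g ⋆ w⁻¹ i)
    R▷v i = TriangularSystem.solves A.R A.R-nonzeroDiagonal (g ⋆ w⁻¹ i)

    Hs : Fin L → Series
    Hs i = tₛ ⋆ v i

    d-valid : ValidG d
    d-valid = ▷-InKtl-reflect A.R A.R-nonzeroDiagonal A.R-gradePreserving (InKtl-resp (≈ₛ-sym R▷d) InKtl-oneₛ) ,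
              λ d0≈0 → 1≉0 (trans (sym (R▷d 0)) (trans (A.R▷-constant d) (trans (*-congˡ d0≈0) (zeroʳ _))))

    v-InKtl : ∀ i → InKtl (v i)
    v-InKtl i = ▷-InKtl-reflect A.R A.R-nonzeroDiagonal A.R-gradePreserving
      (InKtl-resp (≈ₛ-sym (R▷v i)) (InKtl-⋆ A.g-InKtl (InKtl-inverse (A.w0≉0 i) (A.w-InKtl i))))

    v0≉0 : ∀ i → v i 0 ≉ 0#
    v0≉0 i v0≈0 = ⋆-constant-≉0 g (w⁻¹ i) A.g0≉0 (Inverse.b⁻¹-constant-≉0 (A.w i) (A.w0≉0 i))
      (trans (sym (R▷v i 0)) (trans (A.R▷-constant (v i)) (trans (*-congˡ v0≈0) (zeroʳ _))))

    Hs-valid : ValidFs Hs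
    Hs-valid i = (v i , v-InKtl i , ≈ₛ-refl) , ≉0-resp-≈ (sym (t⋆≈shift (v i) 1)) (v0≉0 i)

    module A·N = Product g Fs g-valid Fs-valid d Hs d-valid Hs-valid

    F″≈t : ∀ i → A·N.F″ i ≈ₛ tₛ
    F″≈t i = begin
      (Fs i ⋆ (A.R ▷ v i)) ⋆ A.g⁻¹               ≈⟨ ⋆-congʳ A.g⁻¹ (⋆-cong (A.Fs≈t⋆w i) (R▷v i)) ⟩
      ((tₛ ⋆ A.w i) ⋆ (g ⋆ w⁻¹ i)) ⋆ A.g⁻¹       ≈⟨ ⋆-congʳ A.g⁻¹ (interchange tₛ (A.w i) g (w⁻¹ i)) ⟩
      ((tₛ ⋆ g) ⋆ (A.w i ⋆ w⁻¹ i)) ⋆ A.g⁻¹       ≈⟨ ⋆-congʳ A.g⁻¹ (⋆-congˡ (tₛ ⋆ g) (Inverse.b⁻¹-inverseʳ (A.w i) (A.w0≉0 i))) ⟩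
      ((tₛ ⋆ g) ⋆ oneₛ) ⋆ A.g⁻¹                  ≈⟨ ⋆-congʳ A.g⁻¹ (⋆-identityʳ (tₛ ⋆ g)) ⟩
      (tₛ ⋆ g) ⋆ A.g⁻¹                           ≈⟨ ⋆-assoc tₛ g A.g⁻¹ ⟩
      tₛ ⋆ (g ⋆ A.g⁻¹)                           ≈⟨ ⋆-congˡ tₛ A.g⁻¹-inverseʳ ⟩
      tₛ ⋆ oneₛ                                  ≈⟨ ⋆-identityʳ tₛ ⟩
      tₛ                                         ∎
      where open ≈ₛ-Reasoning

    N : Matrix
    N = riordan d Hs

    R·N≈I : (A.R ·ₘ N) ≈ₘ Iₘ
    R·N≈I = ≈ₘ-trans A·N.product (≈ₘ-trans (riordan-cong R▷d F″≈t) (≈ₘ-sym Iₘ≈riordan))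

  N·R≈I : ∀ g Fs (g-valid : ValidG g) (Fs-valid : ValidFs Fs) → (RiordanInverse.N g Fs g-valid Fs-valid ·ₘ riordan g Fs) ≈ₘ Iₘ
  N·R≈I g Fs g-valid Fs-valid =
    rightInverse⇒leftInverse (riordan g Fs) N (RiordanInverse.N d Hs d-valid Hs-valid)
      (riordan-lowerTriangular g-valid Fs-valid) (riordan-lowerTriangular d-valid Hs-valid)
      R·N≈I (RiordanInverse.R·N≈I d Hs d-valid Hs-valid)
    where open RiordanInverse g Fs g-valid Fs-valid

module AlmostRiordanArrays {c ℓ} (K : Field c ℓ) (L : ℕ) .{{_ : NonZero L}} where
  open Field K hiding (zero)
  open FieldDefs K
  open WithL L
  open FieldProperties K
  open FiniteSums K
  open SeriesRing K
  open Series K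
  open SeriesInKtl K L
  open InfiniteMatrices K L
  open RiordanArrays K L

  almostRiordan-cong : ∀ {b b′ g g′ Fs Fs′} → b ≈ₛ b′ → g ≈ₛ g′ → (∀ i → Fs i ≈ₛ Fs′ i) →
                       almostRiordan b g Fs ≈ₘ almostRiordan b′ g′ Fs′
  almostRiordan-cong b≈b′ g≈g′ Fs≈Fs′ n zero    = b≈b′ n
  almostRiordan-cong b≈b′ g≈g′ Fs≈Fs′ n (suc k) = ⋆-congˡ tₛ (riordanCol-cong g≈g′ Fs≈Fs′ k) n

  Iₘ≈almostRiordan : Iₘ ≈ₘ almostRiordan oneₛ oneₛ (λ _ → tₛ)
  Iₘ≈almostRiordan n zero    = trans (Iₘ≈δ n 0) (sym (oneₛ≈δ0 n))
  Iₘ≈almostRiordan n (suc k) = trans (Iₘ≈δ n (suc k))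
    (sym (trans (⋆-congˡ tₛ (identity-col k) n) (trans (t⋆≈shift (δ k) n) (shift-δ k n))))

  almostRiordan-·ₘ : ∀ b g Fs b′ g′ Fs′ G Gs → (riordan g Fs ·ₘ riordan g′ Fs′) ≈ₘ riordan G Gs →
                     (almostRiordan b g Fs ·ₘ almostRiordan b′ g′ Fs′) ≈ₘ almostRiordan (almostRiordan b g Fs ▷ b′) G Gs
  almostRiordan-·ₘ b g Fs b′ g′ Fs′ G Gs RR′≈R″ n       zero    = refl
  almostRiordan-·ₘ b g Fs b′ g′ Fs′ G Gs RR′≈R″ zero    (suc j) =
    trans (+-identityˡ _) (trans (*-congˡ (t⋆≈shift (riordanCol g′ Fs′ j) 0)) (trans (zeroʳ _) (sym (t⋆≈shift (riordanCol G Gs j) 0))))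
  almostRiordan-·ₘ b g Fs b′ g′ Fs′ G Gs RR′≈R″ (suc m) (suc j) = begin
    Σ< (suc (suc m)) (λ k → A (suc m) k * A′ k (suc j))
      ≈⟨ Σ-uncons (suc m) _ ⟩
    A (suc m) 0 * A′ 0 (suc j) + Σ< (suc m) (λ k → A (suc m) (suc k) * A′ (suc k) (suc j))
      ≈⟨ +-cong (trans (*-congˡ (t⋆≈shift (riordanCol g′ Fs′ j) 0)) (zeroʳ _))
                (Σ-cong (suc m) (λ k → *-cong (t⋆≈shift (riordanCol g Fs k) (suc m)) (t⋆≈shift (riordanCol g′ Fs′ j) (suc k)))) ⟩
    0# + (riordan g Fs ·ₘ riordan g′ Fs′) m j
      ≈⟨ +-identityˡ _ ⟩
    (riordan g Fs ·ₘ riordan g′ Fs′) m j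
      ≈⟨ RR′≈R″ m j ⟩
    riordanCol G Gs j m
      ≈⟨ t⋆≈shift (riordanCol G Gs j) (suc m) ⟨
    (tₛ ⋆ riordanCol G Gs j) (suc m)
      ∎
    where
    open SetoidReasoning setoid
    A  = almostRiordan b g Fs
    A′ = almostRiordan b′ g′ Fs′

  module AlmostValid (b g : Series) (Fs : Fin L → Series) (b-valid : ValidG b) (g-valid : ValidG g) (Fs-valid : ValidFs Fs) where
    open Valid g Fs g-valid Fs-valid using (col; col-order; col-diagonal; col-homogeneous)

    A : Matrix
    A = almostRiordan b g Fs

    A-lowerTriangular : LowerTriangular A
    A-lowerTriangular n       zero    ()
    A-lowerTriangular zero    (suc k) _           = t⋆≈shift (col k) 0
    A-lowerTriangular (suc n) (suc k) (ℕ.s≤s n<k) = trans (t⋆≈shift (col k) (suc n)) (col-order k n n<k)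

    A-nonzeroDiagonal : NonzeroDiagonal A
    A-nonzeroDiagonal zero    = proj₂ b-valid
    A-nonzeroDiagonal (suc k) = ≉0-resp-≈ (sym (t⋆≈shift (col k) (suc k))) (col-diagonal k)

    A-gradePreserving : GradePreserving A
    A-gradePreserving n zero    _   = proj₁ b-valid n
    A-gradePreserving n (suc k) L∣k = Homogeneous⇒InKtl L∣k
      (Homogeneous-resp (suc k) (≈ₛ-sym (t⋆≈shift (col k))) (Homogeneous-shift k (col k) (col-homogeneous k))) n

    A▷-constant : ∀ v → (A ▷ v) 0 ≈ b 0 * v 0
    A▷-constant v = +-identityˡ _

    A▷-valid : ∀ {b′} → ValidG b′ → ValidG (A ▷ b′)
    A▷-valid {b′} (b′∈ , b′0≉0) = ▷-InKtl A A-gradePreserving b′∈ , ≉0-resp-≈ (sym (A▷-constant b′)) (*-≉0 (proj₂ b-valid) b′0≉0)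

    module RightInverse (d : Series) (Hs : Fin L → Series) (R·N≈I : (riordan g Fs ·ₘ riordan d Hs) ≈ₘ Iₘ) where
      b⁻ : Series
      b⁻ = TriangularSystem.solution A A-nonzeroDiagonal oneₛ

      A▷b⁻ : (A ▷ b⁻) ≈ₛ oneₛ
      A▷b⁻ = TriangularSystem.solves A A-nonzeroDiagonal oneₛ

      b⁻-valid : ValidG b⁻
      b⁻-valid = ▷-InKtl-reflect A A-nonzeroDiagonal A-gradePreserving (InKtl-resp (≈ₛ-sym A▷b⁻) InKtl-oneₛ) ,
                 λ b⁻0≈0 → 1≉0 (trans (sym (A▷b⁻ 0)) (trans (A▷-constant b⁻) (trans (*-congˡ b⁻0≈0) (zeroʳ _))))

      A·X≈I : (A ·ₘ almostRiordan b⁻ d Hs) ≈ₘ Iₘ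
      A·X≈I = ≈ₘ-trans (almostRiordan-·ₘ b g Fs b⁻ d Hs oneₛ (λ _ → tₛ) (≈ₘ-trans R·N≈I Iₘ≈riordan))
                       (≈ₘ-trans (almostRiordan-cong A▷b⁻ ≈ₛ-refl (λ _ → ≈ₛ-refl)) (≈ₘ-sym Iₘ≈almostRiordan))

  almostRiordan-lowerTriangular : ∀ {b g Fs} → ValidG b → ValidG g → ValidFs Fs → LowerTriangular (almostRiordan b g Fs)
  almostRiordan-lowerTriangular b-valid g-valid Fs-valid = AlmostValid.A-lowerTriangular _ _ _ b-valid g-valid Fs-valid

  almostRiordan-inverse : ∀ b g Fs d Hs → ValidG b → ValidG g → ValidFs Fs → ValidG d → ValidFs Hs →
                          (riordan g Fs ·ₘ riordan d Hs) ≈ₘ Iₘ → (riordan d Hs ·ₘ riordan g Fs) ≈ₘ Iₘ →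
                          Σ Series λ b⁻ → ValidG b⁻ × ((almostRiordan b g Fs ·ₘ almostRiordan b⁻ d Hs) ≈ₘ Iₘ)
                                                    × ((almostRiordan b⁻ d Hs ·ₘ almostRiordan b g Fs) ≈ₘ Iₘ)
  almostRiordan-inverse b g Fs d Hs b-valid g-valid Fs-valid d-valid Hs-valid R·N≈I N·R≈I =
    X.b⁻ , X.b⁻-valid , X.A·X≈I ,
    rightInverse⇒leftInverse (almostRiordan b g Fs) (almostRiordan X.b⁻ d Hs) (almostRiordan Y.b⁻ g Fs)
      (almostRiordan-lowerTriangular b-valid g-valid Fs-valid) (almostRiordan-lowerTriangular X.b⁻-valid d-valid Hs-valid)
      X.A·X≈I Y.A·X≈I
    where
    module X = AlmostValid.RightInverse b g Fs b-valid g-valid Fs-valid d Hs R·N≈I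
    module Y = AlmostValid.RightInverse X.b⁻ d Hs X.b⁻-valid d-valid Hs-valid g Fs N·R≈I

module AlmostRiordanSubgroups {c ℓ} (K : Field c ℓ) (L : ℕ) .{{_ : NonZero L}} where
  open Field K hiding (zero)
  open FieldDefs K
  open WithL L
  open SeriesRing K
  open Series K
  open InfiniteMatrices K L
  open RiordanArrays K L
  open AlmostRiordanArrays K L

  IsSubgroupOf-⇔ : ∀ {p q r} {G : Matrix → Set p} {S : Matrix → Set q} {T : Matrix → Set r} →
                   (∀ {M} → S M → T M) → (∀ {M} → T M → S M) → IsSubgroupOf G S → IsSubgroupOf G T
  IsSubgroupOf-⇔ S⇒T T⇒S S-subgroup = record
    { respects  = λ A B A≈B A∈T → S⇒T (respects A B A≈B (T⇒S A∈T))
    ; subset    = λ A A∈T → subset A (T⇒S A∈T)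
    ; hasId     = S⇒T hasId
    ; closedMul = λ A B A∈T B∈T → S⇒T (closedMul A B (T⇒S A∈T) (T⇒S B∈T))
    ; closedInv = λ A A∈T → let (B , B∈S , AB≈I , BA≈I) = closedInv A (T⇒S A∈T) in B , S⇒T B∈S , AB≈I , BA≈I
    }
    where open IsSubgroupOf S-subgroup

  module Lifting {p} (P : Series → (Fin L → Series) → Set p)
    (P-identity : P oneₛ (λ _ → tₛ))
    (P-product : ∀ {g Fs d Hs} (g-valid : ValidG g) (Fs-valid : ValidFs Fs) (d-valid : ValidG d) (Hs-valid : ValidFs Hs) →
                 P g Fs → P d Hs →
                 P (Product.g″ g Fs g-valid Fs-valid d Hs d-valid Hs-valid) (Product.F″ g Fs g-valid Fs-valid d Hs d-valid Hs-valid))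
    (P-inverse : ∀ {g Fs} (g-valid : ValidG g) (Fs-valid : ValidFs Fs) →
                 P g Fs → P (RiordanInverse.d g Fs g-valid Fs-valid) (RiordanInverse.Hs g Fs g-valid Fs-valid))
    where

    Lift : Matrix → Set (c ⊔ ℓ ⊔ p)
    Lift M = Σ Series λ b → Σ Series λ g → Σ (Fin L → Series) λ Fs →
               ValidG b × ValidG g × ValidFs Fs × P g Fs × (M ≈ₘ almostRiordan b g Fs)

    closedMul : ∀ A B → Lift A → Lift B → Lift (A ·ₘ B)
    closedMul A B (b , g , Fs , b-valid , g-valid , Fs-valid , g,Fs∈P , A≈) (b′ , d , Hs , b′-valid , d-valid , Hs-valid , d,Hs∈P , B≈) =
      almostRiordan b g Fs ▷ b′ , g″ , F″ ,
      AlmostValid.A▷-valid b g Fs b-valid g-valid Fs-valid b′-valid , g″-valid , F″-valid ,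
      P-product g-valid Fs-valid d-valid Hs-valid g,Fs∈P d,Hs∈P ,
      ≈ₘ-trans (·ₘ-cong A≈ B≈) (almostRiordan-·ₘ b g Fs b′ d Hs g″ F″ product)
      where open Product g Fs g-valid Fs-valid d Hs d-valid Hs-valid

    closedInv : ∀ A → Lift A → Σ Matrix λ B → Lift B × ((A ·ₘ B) ≈ₘ Iₘ) × ((B ·ₘ A) ≈ₘ Iₘ)
    closedInv A (b , g , Fs , b-valid , g-valid , Fs-valid , g,Fs∈P , A≈) =
      let (b⁻ , b⁻-valid , AX≈I , XA≈I) = almostRiordan-inverse b g Fs d Hs b-valid g-valid Fs-valid d-valid Hs-valid
                                            R·N≈I (N·R≈I g Fs g-valid Fs-valid)
      in almostRiordan b⁻ d Hs , (b⁻ , d , Hs , b⁻-valid , d-valid , Hs-valid , P-inverse g-valid Fs-valid g,Fs∈P , ≈ₘ-refl) ,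
         ≈ₘ-trans (·ₘ-congˡ (almostRiordan b⁻ d Hs) A≈) AX≈I ,
         ≈ₘ-trans (·ₘ-congʳ (almostRiordan b⁻ d Hs) A≈) XA≈I
      where open RiordanInverse g Fs g-valid Fs-valid

    isSubgroup : IsSubgroupOf InMaR Lift
    isSubgroup = record
      { respects  = λ A B A≈B (b , g , Fs , b-valid , g-valid , Fs-valid , g,Fs∈P , A≈) →
                      b , g , Fs , b-valid , g-valid , Fs-valid , g,Fs∈P , ≈ₘ-trans (≈ₘ-sym A≈B) A≈
      ; subset    = λ A (b , g , Fs , b-valid , g-valid , Fs-valid , _ , A≈) → b , g , Fs , b-valid , g-valid , Fs-valid , A≈
      ; hasId     = oneₛ , oneₛ , (λ _ → tₛ) , oneₛ-valid , oneₛ-valid , tₛ-valid , P-identity , Iₘ≈almostRiordan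
      ; closedMul = closedMul
      ; closedInv = closedInv
      }

  liftSet-isSubgroup : ∀ {q} (S : Matrix → Set q) → IsSubgroupOf InMR S → IsSubgroupOf InMaR (LiftSet S)
  liftSet-isSubgroup S S-subgroup = Lifting.isSubgroup (λ g Fs → S (riordan g Fs)) S-identity S-product S-inverse
    where
    open IsSubgroupOf S-subgroup
    S-identity : S (riordan oneₛ (λ _ → tₛ))
    S-identity = respects Iₘ _ Iₘ≈riordan hasId
    S-product : ∀ {g Fs d Hs} (g-valid : ValidG g) (Fs-valid : ValidFs Fs) (d-valid : ValidG d) (Hs-valid : ValidFs Hs) →
                S (riordan g Fs) → S (riordan d Hs) →
                S (riordan (Product.g″ g Fs g-valid Fs-valid d Hs d-valid Hs-valid) (Product.F″ g Fs g-valid Fs-valid d Hs d-valid Hs-valid))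
    S-product {g} {Fs} {d} {Hs} g-valid Fs-valid d-valid Hs-valid R∈S R′∈S =
      respects _ _ (Product.product g Fs g-valid Fs-valid d Hs d-valid Hs-valid) (closedMul _ _ R∈S R′∈S)
    S-inverse : ∀ {g Fs} (g-valid : ValidG g) (Fs-valid : ValidFs Fs) → S (riordan g Fs) →
                S (riordan (RiordanInverse.d g Fs g-valid Fs-valid) (RiordanInverse.Hs g Fs g-valid Fs-valid))
    S-inverse {g} {Fs} g-valid Fs-valid R∈S =
      let (B , B∈S , R·B≈I , _) = closedInv (riordan g Fs) R∈S
      in respects B N (≈ₘ-sym (leftInverse≈rightInverse N (riordan g Fs) B (riordan-lowerTriangular d-valid Hs-valid)
                                 (riordan-lowerTriangular g-valid Fs-valid) (N·R≈I g Fs g-valid Fs-valid) R·B≈I)) B∈S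
      where open RiordanInverse g Fs g-valid Fs-valid

  module _ (j : Fin L) where

    FjIsT⋆g : Series → (Fin L → Series) → Set ℓ
    FjIsT⋆g g Fs = Fs j ≈ₛ (tₛ ⋆ g)

    FjIsT⋆g-product : ∀ {g Fs d Hs} (g-valid : ValidG g) (Fs-valid : ValidFs Fs) (d-valid : ValidG d) (Hs-valid : ValidFs Hs) →
                      FjIsT⋆g g Fs → FjIsT⋆g d Hs →
                      FjIsT⋆g (Product.g″ g Fs g-valid Fs-valid d Hs d-valid Hs-valid) (Product.F″ g Fs g-valid Fs-valid d Hs d-valid Hs-valid)
    FjIsT⋆g-product {g} {Fs} {d} {Hs} g-valid Fs-valid d-valid Hs-valid Fj≈tg Hj≈td = begin
      (Fs j ⋆ (A.R ▷ B.w j)) ⋆ A.g⁻¹     ≈⟨ ⋆-congʳ A.g⁻¹ (⋆-cong Fj≈tg (▷-congʳ A.R wj≈d)) ⟩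
      ((tₛ ⋆ g) ⋆ g″) ⋆ A.g⁻¹            ≈⟨ ⋆-congʳ A.g⁻¹ (xy∙z≈xz∙y tₛ g g″) ⟩
      ((tₛ ⋆ g″) ⋆ g) ⋆ A.g⁻¹            ≈⟨ ⋆-assoc (tₛ ⋆ g″) g A.g⁻¹ ⟩
      (tₛ ⋆ g″) ⋆ (g ⋆ A.g⁻¹)            ≈⟨ ⋆-congˡ (tₛ ⋆ g″) A.g⁻¹-inverseʳ ⟩
      (tₛ ⋆ g″) ⋆ oneₛ                   ≈⟨ ⋆-identityʳ (tₛ ⋆ g″) ⟩
      tₛ ⋆ g″                            ∎
      where
      open ≈ₛ-Reasoning
      open Product g Fs g-valid Fs-valid d Hs d-valid Hs-valid
      wj≈d : B.w j ≈ₛ d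
      wj≈d = t⋆-cancel (≈ₛ-trans (≈ₛ-sym (B.Fs≈t⋆w j)) Hj≈td)

    FjIsT⋆g-inverse : ∀ {g Fs} (g-valid : ValidG g) (Fs-valid : ValidFs Fs) → FjIsT⋆g g Fs →
                      FjIsT⋆g (RiordanInverse.d g Fs g-valid Fs-valid) (RiordanInverse.Hs g Fs g-valid Fs-valid)
    FjIsT⋆g-inverse {g} {Fs} g-valid Fs-valid Fj≈tg = ⋆-congˡ tₛ vj≈d
      where
      open RiordanInverse g Fs g-valid Fs-valid
      wj≈g : A.w j ≈ₛ g
      wj≈g = t⋆-cancel (≈ₛ-trans (≈ₛ-sym (A.Fs≈t⋆w j)) Fj≈tg)
      g⋆w⁻¹≈1 : (g ⋆ w⁻¹ j) ≈ₛ oneₛ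
      g⋆w⁻¹≈1 = ≈ₛ-trans (⋆-congʳ (w⁻¹ j) (≈ₛ-sym wj≈g)) (Inverse.b⁻¹-inverseʳ (A.w j) (A.w0≉0 j))
      vj≈d : v j ≈ₛ d
      vj≈d = ▷-injective A.R A.R-nonzeroDiagonal (≈ₛ-trans (R▷v j) (≈ₛ-trans g⋆w⁻¹≈1 (≈ₛ-sym R▷d)))

    bSet-isSubgroup : IsSubgroupOf InMaR (BSet j)
    bSet-isSubgroup = Lifting.isSubgroup FjIsT⋆g (≈ₛ-sym (⋆-identityʳ tₛ)) FjIsT⋆g-product FjIsT⋆g-inverse

module DerivativeSubgroup {c ℓ} (K : Field c ℓ) (L : ℕ) .{{_ : NonZero L}} (charZero : FieldDefs.CharZero K) where
  open Field K hiding (zero)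
  open FieldDefs K
  open WithL L
  open FieldProperties K
  open FiniteSums K
  open SeriesRing K
  open Series K
  open SeriesInKtl K L
  open InfiniteMatrices K L
  open RiordanArrays K L
  open AlmostRiordanArrays K L
  open AlmostRiordanSubgroups K L

  module ChainRule (g : Series) (Fs : Fin L → Series) (g-valid : ValidG g) (Fs-valid : ValidFs Fs)
                   (h : Series) (h′≈g : deriv h ≈ₛ g) (h^L≈ : (h ^ₛ L) ≈ₛ prodF Fs) where
    open Valid g Fs g-valid Fs-valid

    h÷g : Series
    h÷g = h ⋆ g⁻¹

    deriv-col⋆h÷g : ∀ m → L ∣ m → deriv (col m ⋆ h÷g) ≈ₛ (suc m ·ₛ col m)
    deriv-col⋆h÷g m (divides q ≡.refl) = begin
      deriv (col (q ℕ.* L) ⋆ h÷g)                       ≈⟨ deriv-cong col⋆h÷g ⟩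
      deriv (h ^ₛ suc (q ℕ.* L))                        ≈⟨ deriv-^ₛ h (q ℕ.* L) ⟩
      suc (q ℕ.* L) ·ₛ ((h ^ₛ (q ℕ.* L)) ⋆ deriv h)     ≈⟨ ·ₛ-cong (suc (q ℕ.* L)) hᵐ⋆h′ ⟩
      suc (q ℕ.* L) ·ₛ col (q ℕ.* L)                    ∎
      where
      open ≈ₛ-Reasoning
      P = prodF Fs
      col≈ : col (q ℕ.* L) ≈ₛ (g ⋆ (P ^ₛ q))
      col≈ = ≈ₛ-trans (col-+* 0 q) (⋆-congʳ (P ^ₛ q) col-zero)
      P^q≈ : (P ^ₛ q) ≈ₛ (h ^ₛ (q ℕ.* L))
      P^q≈ = ≈ₛ-trans (^ₛ-cong q (≈ₛ-sym h^L≈)) (^ₛ-* h L q)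
      col⋆h÷g : (col (q ℕ.* L) ⋆ h÷g) ≈ₛ (h ^ₛ suc (q ℕ.* L))
      col⋆h÷g = begin
        col (q ℕ.* L) ⋆ (h ⋆ g⁻¹)         ≈⟨ ⋆-congʳ (h ⋆ g⁻¹) col≈ ⟩
        (g ⋆ (P ^ₛ q)) ⋆ (h ⋆ g⁻¹)        ≈⟨ interchange g (P ^ₛ q) h g⁻¹ ⟩
        (g ⋆ h) ⋆ ((P ^ₛ q) ⋆ g⁻¹)        ≈⟨ ⋆-congʳ ((P ^ₛ q) ⋆ g⁻¹) (⋆-comm g h) ⟩
        (h ⋆ g) ⋆ ((P ^ₛ q) ⋆ g⁻¹)        ≈⟨ interchange h g (P ^ₛ q) g⁻¹ ⟩
        (h ⋆ (P ^ₛ q)) ⋆ (g ⋆ g⁻¹)        ≈⟨ ⋆-congˡ (h ⋆ (P ^ₛ q)) g⁻¹-inverseʳ ⟩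
        (h ⋆ (P ^ₛ q)) ⋆ oneₛ             ≈⟨ ⋆-identityʳ (h ⋆ (P ^ₛ q)) ⟩
        h ⋆ (P ^ₛ q)                      ≈⟨ ⋆-congˡ h P^q≈ ⟩
        h ⋆ (h ^ₛ (q ℕ.* L))              ∎
      hᵐ⋆h′ : ((h ^ₛ (q ℕ.* L)) ⋆ deriv h) ≈ₛ col (q ℕ.* L)
      hᵐ⋆h′ = ≈ₛ-trans (⋆-comm (h ^ₛ (q ℕ.* L)) (deriv h))
               (≈ₛ-trans (⋆-cong h′≈g (≈ₛ-sym P^q≈)) (≈ₛ-sym col≈))

    T : Matrix
    T = multiplication h÷g ·ₘ R

    T-entry : ∀ n k → L ∣ k → (suc n ·ₙ T (suc n) k) ≈ (suc k ·ₙ R n k)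
    T-entry n k L∣k = trans (·ₙ-cong (suc n) (multiplication-▷ h÷g (col k) (suc n))) (deriv-col⋆h÷g k L∣k n)

    chain-rule : ∀ {κ} → InKtl κ → deriv ((R ▷ κ) ⋆ h÷g) ≈ₛ (R ▷ deriv (tₛ ⋆ κ))
    chain-rule {κ} κ∈ n = begin
      suc n ·ₙ ((R ▷ κ) ⋆ h÷g) (suc n)
        ≈⟨ ·ₙ-cong (suc n) (⋆-▷ R κ h÷g R-lowerTriangular (suc n)) ⟩
      suc n ·ₙ Σ< (suc (suc n)) (λ k → T (suc n) k * κ k)
        ≈⟨ trans (·ₙ-distrib-Σ (suc n) (suc (suc n)) _) (Σ-cong (suc (suc n)) (λ k → ·ₙ-assocˡ (suc n) _ _)) ⟩
      Σ< (suc (suc n)) (λ k → (suc n ·ₙ T (suc n) k) * κ k)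
        ≈⟨ Σ-cong (suc (suc n)) term ⟩
      Σ< (suc n) (λ k → (suc k ·ₙ R n k) * κ k) + (suc (suc n) ·ₙ R n (suc n)) * κ (suc n)
        ≈⟨ +-congˡ (trans (*-congʳ (trans (·ₙ-cong (suc (suc n)) (R-lowerTriangular n (suc n) ℕₚ.≤-refl)) (·ₙ-zero (suc (suc n))))) (zeroˡ _)) ⟩
      Σ< (suc n) (λ k → (suc k ·ₙ R n k) * κ k) + 0#
        ≈⟨ +-identityʳ _ ⟩
      Σ< (suc n) (λ k → (suc k ·ₙ R n k) * κ k)
        ≈⟨ Σ-cong (suc n) (λ k → trans (sym (·ₙ-assocˡ (suc k) _ _))
                                       (trans (·ₙ-assocʳ (suc k) _ _) (*-congˡ (·ₙ-cong (suc k) (sym (t⋆≈shift κ (suc k))))))) ⟩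
      (R ▷ deriv (tₛ ⋆ κ)) n
        ∎
      where
      open SetoidReasoning setoid
      term : ∀ k → ((suc n ·ₙ T (suc n) k) * κ k) ≈ ((suc k ·ₙ R n k) * κ k)
      term k with L ∣? k
      ... | yes L∣k = *-congʳ (T-entry n k L∣k)
      ... | no  L∤k = trans (*-congˡ (κ∈ k L∤k)) (trans (zeroʳ _) (sym (trans (*-congˡ (κ∈ k L∤k)) (zeroʳ _))))

  RootDerivative : Series → (Fin L → Series) → Set (c ⊔ ℓ)
  RootDerivative g Fs = Σ Series λ h → InTK h × (deriv h ≈ₛ g) × ((h ^ₛ L) ≈ₛ prodF Fs)

  private
    t^L⋆-cancel-prodFin : ∀ {a} (Fs w : Fin L → Series) → (∀ i → Fs i ≈ₛ (tₛ ⋆ w i)) →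
                          ((tₛ ⋆ a) ^ₛ L) ≈ₛ prodF Fs → (a ^ₛ L) ≈ₛ prodFin w
    t^L⋆-cancel-prodFin {a} Fs w Fs≈tw ta^L≈ = tᵏ⋆-cancel L (begin
      (tₛ ^ₛ L) ⋆ (a ^ₛ L)     ≈⟨ ^ₛ-distrib-⋆ tₛ a L ⟨
      (tₛ ⋆ a) ^ₛ L            ≈⟨ ta^L≈ ⟩
      prodFin Fs               ≈⟨ prodFin-cong Fs≈tw ⟩
      prodFin (λ i → tₛ ⋆ w i) ≈⟨ prodFin-t⋆ w ⟩
      (tₛ ^ₛ L) ⋆ prodFin w    ∎)
      where open ≈ₛ-Reasoning

  -- The witness for the product is H = h ⋅ R(k / t) / g, whose derivative is R k′ by the chain rule.
  module RootProduct (g : Series) (Fs : Fin L → Series) (g-valid : ValidG g) (Fs-valid : ValidFs Fs)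
                     (d : Series) (Hs : Fin L → Series) (d-valid : ValidG d) (Hs-valid : ValidFs Hs)
                     (h : Series) (h∈tK : InTK h) (h′≈g : deriv h ≈ₛ g) (h^L≈ : (h ^ₛ L) ≈ₛ prodF Fs)
                     (k : Series) (k∈tK : InTK k) (k′≈d : deriv k ≈ₛ d) (k^L≈ : (k ^ₛ L) ≈ₛ prodF Hs) where
    open Product g Fs g-valid Fs-valid d Hs d-valid Hs-valid
    open ChainRule g Fs g-valid Fs-valid h h′≈g h^L≈

    κ : Series
    κ = tail k

    κ∈ : InKtl κ
    κ∈ = InKtl-tail charZero {k} (InKtl-resp (≈ₛ-sym k′≈d) B.g-InKtl)

    H : Series
    H = h ⋆ ((A.R ▷ κ) ⋆ A.g⁻¹)

    H∈tK : InTK H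
    H∈tK = proj₁ h∈tK ⋆ ((A.R ▷ κ) ⋆ A.g⁻¹) ,
           ≈ₛ-trans (⋆-congʳ ((A.R ▷ κ) ⋆ A.g⁻¹) (proj₂ h∈tK)) (⋆-assoc tₛ (proj₁ h∈tK) ((A.R ▷ κ) ⋆ A.g⁻¹))

    H′≈g″ : deriv H ≈ₛ g″
    H′≈g″ = begin
      deriv (h ⋆ ((A.R ▷ κ) ⋆ A.g⁻¹))    ≈⟨ deriv-cong (x∙yz≈y∙xz h (A.R ▷ κ) A.g⁻¹) ⟩
      deriv ((A.R ▷ κ) ⋆ h÷g)            ≈⟨ chain-rule κ∈ ⟩
      A.R ▷ deriv (tₛ ⋆ κ)               ≈⟨ ▷-congʳ A.R (deriv-cong (≈t⋆tail k∈tK)) ⟨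
      A.R ▷ deriv k                      ≈⟨ ▷-congʳ A.R k′≈d ⟩
      A.R ▷ d                            ∎
      where open ≈ₛ-Reasoning

    Rκ^L≈ : ((A.R ▷ κ) ^ₛ L) ≈ₛ prodFin (λ i → A.R ▷ B.w i)
    Rκ^L≈ = A.g⋆-cancel (begin
      g ⋆ ((A.R ▷ κ) ^ₛ L)                          ≈⟨ ⋆-congˡ g (prodFin-const L (A.R ▷ κ)) ⟨
      g ⋆ prodFin {L} (λ _ → A.R ▷ κ)               ≈⟨ A.R▷-prodFin L (λ _ → κ) (λ _ → κ∈) ⟨
      (g ^ₛ L) ⋆ (A.R ▷ prodFin {L} (λ _ → κ))      ≈⟨ ⋆-congˡ (g ^ₛ L) (▷-congʳ A.R (≈ₛ-trans (prodFin-const L κ) κ^L≈)) ⟩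
      (g ^ₛ L) ⋆ (A.R ▷ prodFin B.w)                ≈⟨ A.R▷-prodFin L B.w B.w-InKtl ⟩
      g ⋆ prodFin (λ i → A.R ▷ B.w i)               ∎)
      where
      open ≈ₛ-Reasoning
      κ^L≈ : (κ ^ₛ L) ≈ₛ prodFin B.w
      κ^L≈ = t^L⋆-cancel-prodFin Hs B.w B.Fs≈t⋆w (≈ₛ-trans (^ₛ-cong L (≈ₛ-sym (≈t⋆tail k∈tK))) k^L≈)

    H^L≈ : (H ^ₛ L) ≈ₛ prodF F″
    H^L≈ = begin
      (h ⋆ ((A.R ▷ κ) ⋆ A.g⁻¹)) ^ₛ L                       ≈⟨ ^ₛ-distrib-⋆ h _ L ⟩
      (h ^ₛ L) ⋆ (((A.R ▷ κ) ⋆ A.g⁻¹) ^ₛ L)                ≈⟨ ⋆-cong h^L≈ (^ₛ-distrib-⋆ (A.R ▷ κ) A.g⁻¹ L) ⟩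
      prodF Fs ⋆ (((A.R ▷ κ) ^ₛ L) ⋆ (A.g⁻¹ ^ₛ L))         ≈⟨ ⋆-congˡ (prodF Fs) (⋆-congʳ (A.g⁻¹ ^ₛ L) Rκ^L≈) ⟩
      prodF Fs ⋆ (prodFin Rw ⋆ (A.g⁻¹ ^ₛ L))               ≈⟨ ⋆-assoc (prodF Fs) (prodFin Rw) (A.g⁻¹ ^ₛ L) ⟨
      (prodF Fs ⋆ prodFin Rw) ⋆ (A.g⁻¹ ^ₛ L)               ≈⟨ ⋆-congʳ (A.g⁻¹ ^ₛ L) (prodFin-⋆ Fs Rw) ⟨
      prodFin (λ i → Fs i ⋆ Rw i) ⋆ (A.g⁻¹ ^ₛ L)           ≈⟨ prodFin-⋆-const (λ i → Fs i ⋆ Rw i) A.g⁻¹ ⟨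
      prodF F″                                             ∎
      where
      open ≈ₛ-Reasoning
      Rw : Fin L → Series
      Rw i = A.R ▷ B.w i

  -- With h = t u, the witness for the inverse is t κ where R κ = g / u, so that (R κ) h / g = t.
  module RootInverse (g : Series) (Fs : Fin L → Series) (g-valid : ValidG g) (Fs-valid : ValidFs Fs)
                     (h : Series) (h∈tK : InTK h) (h′≈g : deriv h ≈ₛ g) (h^L≈ : (h ^ₛ L) ≈ₛ prodF Fs) where
    open RiordanInverse g Fs g-valid Fs-valid
    open ChainRule g Fs g-valid Fs-valid h h′≈g h^L≈

    u : Series
    u = tail h

    u0≉0 : u 0 ≉ 0#
    u0≉0 = ≉0-resp-≈ (trans (sym (h′≈g 0)) (tail-constant h)) A.g0≉0

    open Inverse u u0≉0 using () renaming (b⁻¹ to u⁻¹; b⁻¹-inverseʳ to u⁻¹-inverseʳ; b⁻¹-inverseˡ to u⁻¹-inverseˡ)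

    g⋆u⁻¹-InKtl : InKtl (g ⋆ u⁻¹)
    g⋆u⁻¹-InKtl = InKtl-⋆ A.g-InKtl (InKtl-inverse u0≉0 (InKtl-tail charZero {h} (InKtl-resp (≈ₛ-sym h′≈g) A.g-InKtl)))

    κ : Series
    κ = TriangularSystem.solution A.R A.R-nonzeroDiagonal (g ⋆ u⁻¹)

    R▷κ : (A.R ▷ κ) ≈ₛ (g ⋆ u⁻¹)
    R▷κ = TriangularSystem.solves A.R A.R-nonzeroDiagonal (g ⋆ u⁻¹)

    κ∈ : InKtl κ
    κ∈ = ▷-InKtl-reflect A.R A.R-nonzeroDiagonal A.R-gradePreserving (InKtl-resp (≈ₛ-sym R▷κ) g⋆u⁻¹-InKtl)

    R▷κ⋆h÷g≈t : ((A.R ▷ κ) ⋆ h÷g) ≈ₛ tₛ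
    R▷κ⋆h÷g≈t = begin
      (A.R ▷ κ) ⋆ (h ⋆ A.g⁻¹)                  ≈⟨ ⋆-cong R▷κ (⋆-congʳ A.g⁻¹ (≈t⋆tail h∈tK)) ⟩
      (g ⋆ u⁻¹) ⋆ ((tₛ ⋆ u) ⋆ A.g⁻¹)           ≈⟨ ⋆-congˡ (g ⋆ u⁻¹) (⋆-assoc tₛ u A.g⁻¹) ⟩
      (g ⋆ u⁻¹) ⋆ (tₛ ⋆ (u ⋆ A.g⁻¹))           ≈⟨ x∙yz≈y∙xz (g ⋆ u⁻¹) tₛ (u ⋆ A.g⁻¹) ⟩
      tₛ ⋆ ((g ⋆ u⁻¹) ⋆ (u ⋆ A.g⁻¹))           ≈⟨ ⋆-congˡ tₛ (⋆-congˡ (g ⋆ u⁻¹) (⋆-comm u A.g⁻¹)) ⟩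
      tₛ ⋆ ((g ⋆ u⁻¹) ⋆ (A.g⁻¹ ⋆ u))           ≈⟨ ⋆-congˡ tₛ (interchange g u⁻¹ A.g⁻¹ u) ⟩
      tₛ ⋆ ((g ⋆ A.g⁻¹) ⋆ (u⁻¹ ⋆ u))           ≈⟨ ⋆-congˡ tₛ (⋆-cong A.g⁻¹-inverseʳ u⁻¹-inverseˡ) ⟩
      tₛ ⋆ (oneₛ ⋆ oneₛ)                       ≈⟨ ⋆-congˡ tₛ (⋆-identityˡ oneₛ) ⟩
      tₛ ⋆ oneₛ                                ≈⟨ ⋆-identityʳ tₛ ⟩
      tₛ                                       ∎
      where open ≈ₛ-Reasoning

    hb : Series
    hb = tₛ ⋆ κ

    hb∈tK : InTK hb
    hb∈tK = κ , ≈ₛ-refl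

    hb′≈d : deriv hb ≈ₛ d
    hb′≈d = ▷-injective A.R A.R-nonzeroDiagonal (begin
      A.R ▷ deriv (tₛ ⋆ κ)          ≈⟨ chain-rule κ∈ ⟨
      deriv ((A.R ▷ κ) ⋆ h÷g)       ≈⟨ deriv-cong R▷κ⋆h÷g≈t ⟩
      deriv tₛ                      ≈⟨ deriv-t ⟩
      oneₛ                          ≈⟨ R▷d ⟨
      A.R ▷ d                       ∎)
      where open ≈ₛ-Reasoning

    u⁻¹^L≈ : (u⁻¹ ^ₛ L) ≈ₛ prodFin w⁻¹
    u⁻¹^L≈ = inverse-unique (u ^ₛ L)
      (≈ₛ-trans (≈ₛ-sym (^ₛ-distrib-⋆ u u⁻¹ L)) (≈ₛ-trans (^ₛ-cong L u⁻¹-inverseʳ) (oneₛ-^ₛ L)))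
      (≈ₛ-trans (⋆-congʳ (prodFin w⁻¹) u^L≈)
        (≈ₛ-trans (≈ₛ-sym (prodFin-⋆ A.w w⁻¹)) (prodFin-oneₛ (λ i → A.w i ⋆ w⁻¹ i) (λ i → Inverse.b⁻¹-inverseʳ (A.w i) (A.w0≉0 i)))))
      where
      u^L≈ : (u ^ₛ L) ≈ₛ prodFin A.w
      u^L≈ = t^L⋆-cancel-prodFin Fs A.w A.Fs≈t⋆w (≈ₛ-trans (^ₛ-cong L (≈ₛ-sym (≈t⋆tail h∈tK))) h^L≈)

    κ^L≈ : (κ ^ₛ L) ≈ₛ prodFin v
    κ^L≈ = ▷-injective A.R A.R-nonzeroDiagonal
      (Inverse.b⋆-cancel (g ^ₛ L) (^ₛ-constant-≉0 g L A.g0≉0) (begin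
        (g ^ₛ L) ⋆ (A.R ▷ (κ ^ₛ L))                 ≈⟨ ⋆-congˡ (g ^ₛ L) (▷-congʳ A.R (prodFin-const L κ)) ⟨
        (g ^ₛ L) ⋆ (A.R ▷ prodFin {L} (λ _ → κ))    ≈⟨ A.R▷-prodFin L (λ _ → κ) (λ _ → κ∈) ⟩
        g ⋆ prodFin {L} (λ _ → A.R ▷ κ)             ≈⟨ ⋆-congˡ g (≈ₛ-trans (prodFin-const L (A.R ▷ κ)) (^ₛ-cong L R▷κ)) ⟩
        g ⋆ ((g ⋆ u⁻¹) ^ₛ L)                        ≈⟨ ⋆-congˡ g (^ₛ-distrib-⋆ g u⁻¹ L) ⟩
        g ⋆ ((g ^ₛ L) ⋆ (u⁻¹ ^ₛ L))                 ≈⟨ ⋆-congˡ g (⋆-cong (≈ₛ-sym (prodFin-const L g)) u⁻¹^L≈) ⟩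
        g ⋆ (prodFin {L} (λ _ → g) ⋆ prodFin w⁻¹)   ≈⟨ ⋆-congˡ g (prodFin-⋆ (λ _ → g) w⁻¹) ⟨
        g ⋆ prodFin (λ i → g ⋆ w⁻¹ i)               ≈⟨ ⋆-congˡ g (prodFin-cong R▷v) ⟨
        g ⋆ prodFin (λ i → A.R ▷ v i)               ≈⟨ A.R▷-prodFin L v v-InKtl ⟨
        (g ^ₛ L) ⋆ (A.R ▷ prodFin v)                ∎))
      where open ≈ₛ-Reasoning

    hb^L≈ : (hb ^ₛ L) ≈ₛ prodF Hs
    hb^L≈ = ≈ₛ-trans (^ₛ-distrib-⋆ tₛ κ L) (≈ₛ-trans (⋆-congˡ (tₛ ^ₛ L) κ^L≈) (≈ₛ-sym (prodFin-t⋆ v)))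

  dSet-isSubgroup : IsSubgroupOf InMaR DSet
  dSet-isSubgroup = IsSubgroupOf-⇔ to-DSet from-DSet (Lifting.isSubgroup RootDerivative root-identity root-product root-inverse)
    where
    root-identity : RootDerivative oneₛ (λ _ → tₛ)
    root-identity = tₛ , (oneₛ , ≈ₛ-sym (⋆-identityʳ tₛ)) , deriv-t , ≈ₛ-sym (prodFin-const L tₛ)

    root-product : ∀ {g Fs d Hs} (g-valid : ValidG g) (Fs-valid : ValidFs Fs) (d-valid : ValidG d) (Hs-valid : ValidFs Hs) →
                   RootDerivative g Fs → RootDerivative d Hs →
                   RootDerivative (Product.g″ g Fs g-valid Fs-valid d Hs d-valid Hs-valid) (Product.F″ g Fs g-valid Fs-valid d Hs d-valid Hs-valid)
    root-product {g} {Fs} {d} {Hs} g-valid Fs-valid d-valid Hs-valid (h , h∈tK , h′≈g , h^L≈) (k , k∈tK , k′≈d , k^L≈) = H , H∈tK , H′≈g″ , H^L≈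
      where open RootProduct g Fs g-valid Fs-valid d Hs d-valid Hs-valid h h∈tK h′≈g h^L≈ k k∈tK k′≈d k^L≈

    root-inverse : ∀ {g Fs} (g-valid : ValidG g) (Fs-valid : ValidFs Fs) → RootDerivative g Fs →
                   RootDerivative (RiordanInverse.d g Fs g-valid Fs-valid) (RiordanInverse.Hs g Fs g-valid Fs-valid)
    root-inverse {g} {Fs} g-valid Fs-valid (h , h∈tK , h′≈g , h^L≈) = hb , hb∈tK , hb′≈d , hb^L≈
      where open RootInverse g Fs g-valid Fs-valid h h∈tK h′≈g h^L≈

    Lift = Lifting.Lift RootDerivative root-identity root-product root-inverse

    to-DSet : ∀ {M} → Lift M → DSet M
    to-DSet (b , g , Fs , b-valid , g-valid , Fs-valid , (h , h∈tK , h′≈g , h^L≈) , M≈) =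
      b , h , Fs , h∈tK , b-valid , ValidG-resp (≈ₛ-sym h′≈g) g-valid , Fs-valid , h^L≈ ,
      ≈ₘ-trans M≈ (almostRiordan-cong ≈ₛ-refl (≈ₛ-sym h′≈g) (λ _ → ≈ₛ-refl))

    from-DSet : ∀ {M} → DSet M → Lift M
    from-DSet (b , h , Fs , h∈tK , b-valid , h′-valid , Fs-valid , h^L≈ , M≈) =
      b , deriv h , Fs , b-valid , h′-valid , Fs-valid , (h , h∈tK , ≈ₛ-refl , h^L≈) , M≈

theorem4p3 : {c ℓ q : Level} (K : Field c ℓ) → FieldDefs.CharZero K →
    (ℓ' : ℕ) .{{_ : NonZero ℓ'}} → 2 ≤ ℓ' →
    let open FieldDefs.WithL K ℓ' in
    ((S : Matrix → Set q) → IsSubgroupOf InMR S →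
       IsSubgroupOf InMaR (LiftSet S))
    × IsSubgroupOf InMaR DSet
    × ((j : Fin ℓ') → IsSubgroupOf InMaR (BSet j))
theorem4p3 K charZero ℓ′ _ =
  AlmostRiordanSubgroups.liftSet-isSubgroup K ℓ′ ,
  DerivativeSubgroup.dSet-isSubgroup K ℓ′ charZero ,
  AlmostRiordanSubgroups.bSet-isSubgroup K ℓ′
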